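{- (a) Let $n,d\ge1$. Then $H(n,d)$ is a central product of subgroups $N_1\cong H(n-1,d)$ and $N_2\cong H(1,1)$; more precisely $H(n,d)\cong (H(n-1,d)\times H(1,1))/B$ for some subgroup $B$ of $Z(H(n-1,d))\times Z(H(1,1))$ of order $p$. (b) Let $n\ge2$, $d\ge1$. Then $A(n,d)$ is a central product of subgroups $N_1\cong A(n-1,d)$ and $N_2\cong H(1,1)$; more precisely $A(n,d)\cong(A(n-1,d)\times H(1,1))/B$ for some subgroup $B$ of $Z(A(n-1,d))\times Z(H(1,1))$ of order $p$.
   Context: $p$ is an odd prime. For $n,d\ge1$, $H(n,d)$ is the group of order $p^{2n+d}$ generated by $x_1,\dots,x_n,y_1,\dots,y_n,z$ with $|x_i|=|y_i|=p$, $|z|=p^d$, all generators commuting pairwise except $[x_i,y_i]=z^{p^{d-1}}$; and $H(0,d)=C_{p^d}$. $A(n,d)$ is the group of order $p^{2n+d}$ generated by $x_1,\dots,x_n,y_1,\dots,y_n,z$ with $|x_i|=p$ ($2\le i\le n$), $|y_i|=p$ ($1\le i\le n$), $x_1^p=z$, $|z|=p^d$, all generators commuting pairwise except $[x_i,y_i]=z^{p^{d-1}}$. A group $G$ is a central product of subgroups $N_1,N_2$ if $N_1\cup N_2$ generates $G$ and every element of $N_1$ commutes with every element of $N_2$. -}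

module Defs where

open import Level using (Level; _⊔_; suc)
open import Data.Nat using (ℕ; zero; _^_; _∸_)
import Data.Nat as ℕ
open import Data.Fin using (Fin; toℕ)
open import Data.Sum using (_⊎_; inj₁; inj₂)
open import Data.Unit using (⊤; tt)
open import Data.Product using (Σ; _×_; _,_; proj₁; proj₂; ∃)
open import Relation.Nullary using (¬_)
open import Relation.Unary using (Pred)
open import Relation.Binary.PropositionalEquality using (_≡_)
open import Algebra.Bundles using (Group)
open import Algebra.Morphism.Structures using (module GroupMorphisms)
import Algebra.Construct.DirectProduct as DP
import Algebra.Properties.Group as GP
import Relation.Binary.Reasoning.Setoid as SetoidR

private variable
  c ℓ c′ ℓ′ ℓS : Level

module _ (G : Group c ℓ) where
  open Group G

  pow : Carrier → ℕ → Carrier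
  pow g zero = ε
  pow g (ℕ.suc k) = g ∙ pow g k

  comm : Carrier → Carrier → Carrier
  comm x y = x ⁻¹ ∙ y ⁻¹ ∙ x ∙ y

  InCenter : Carrier → Set (c ⊔ ℓ)
  InCenter z = ∀ g → z ∙ g ≈ g ∙ z

  record IsSubgroup (N : Pred Carrier ℓS) : Set (c ⊔ ℓ ⊔ ℓS) where
    field
      resp  : ∀ {x y} → x ≈ y → N x → N y
      ε∈    : N ε
      ∙∈    : ∀ {x y} → N x → N y → N (x ∙ y)
      ⁻¹∈   : ∀ {x} → N x → N (x ⁻¹)

  IsNormal : Pred Carrier ℓS → Set (c ⊔ ℓS)
  IsNormal N = ∀ a g → N a → N (g ⁻¹ ∙ a ∙ g)

  data Generated (S : Pred Carrier ℓS) : Carrier → Set (c ⊔ ℓ ⊔ ℓS) where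
    gen  : ∀ {x} → S x → Generated S x
    unit : Generated S ε
    mul  : ∀ {x y} → Generated S x → Generated S y → Generated S (x ∙ y)
    inv  : ∀ {x} → Generated S x → Generated S (x ⁻¹)
    respG : ∀ {x y} → x ≈ y → Generated S x → Generated S y

  IsCentralProduct : Pred Carrier ℓS → Pred Carrier ℓS → Set (c ⊔ ℓ ⊔ ℓS)
  IsCentralProduct N₁ N₂ =
    (∀ g → Generated (λ x → N₁ x ⊎ N₂ x) g) ×
    (∀ a b → N₁ a → N₂ b → a ∙ b ≈ b ∙ a)

  HasSize : Pred Carrier ℓS → ℕ → Set (c ⊔ ℓ ⊔ ℓS)
  HasSize N k = Σ (Fin k → Carrier) λ v →
    (∀ i → N (v i)) × (∀ i j → v i ≈ v j → i ≡ j) × (∀ x → N x → ∃ λ i → x ≈ v i)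

  subgroup : (N : Pred Carrier ℓS) → IsSubgroup N → Group (c ⊔ ℓS) ℓ
  subgroup N sN = record
    { Carrier = Σ Carrier N
    ; _≈_ = λ a b → proj₁ a ≈ proj₁ b
    ; _∙_ = λ a b → (proj₁ a ∙ proj₁ b , ∙∈ (proj₂ a) (proj₂ b))
    ; ε = (ε , ε∈)
    ; _⁻¹ = λ a → (proj₁ a ⁻¹ , ⁻¹∈ (proj₂ a))
    ; isGroup = record
      { isMonoid = record
        { isSemigroup = record
          { isMagma = record
            { isEquivalence = record { refl = refl ; sym = sym ; trans = trans }
            ; ∙-cong = ∙-cong }
          ; assoc = λ a b c → assoc (proj₁ a) (proj₁ b) (proj₁ c) }
        ; identity = (λ a → identityˡ (proj₁ a)) , (λ a → identityʳ (proj₁ a)) }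
      ; inverse = (λ a → inverseˡ (proj₁ a)) , (λ a → inverseʳ (proj₁ a))
      ; ⁻¹-cong = ⁻¹-cong }
    }
    where open IsSubgroup sN

  quotient : (N : Pred Carrier ℓS) → IsSubgroup N → IsNormal N → Group c ℓS
  quotient N sN nN = record
    { Carrier = Carrier
    ; _≈_ = _∼_
    ; _∙_ = _∙_
    ; ε = ε
    ; _⁻¹ = _⁻¹
    ; isGroup = record
      { isMonoid = record
        { isSemigroup = record
          { isMagma = record
            { isEquivalence = record { refl = ∼refl ; sym = ∼sym ; trans = ∼trans }
            ; ∙-cong = ∼∙ }
          ; assoc = λ a b c → ≈⇒∼ (assoc a b c) }
        ; identity = (λ a → ≈⇒∼ (identityˡ a)) , (λ a → ≈⇒∼ (identityʳ a)) }
      ; inverse = (λ a → ≈⇒∼ (inverseˡ a)) , (λ a → ≈⇒∼ (inverseʳ a))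
      ; ⁻¹-cong = ∼⁻¹ }
    }
    where
    open IsSubgroup sN
    open GP G
    open SetoidR setoid
    _∼_ : Carrier → Carrier → Set _
    x ∼ y = N (x ⁻¹ ∙ y)
    ≈⇒∼ : ∀ {x y} → x ≈ y → x ∼ y
    ≈⇒∼ {x} {y} x≈y = resp (sym (trans (∙-congʳ (⁻¹-cong x≈y)) (inverseˡ y))) ε∈
    ∼refl : ∀ {x} → x ∼ x
    ∼refl = ≈⇒∼ refl
    ∼sym : ∀ {x y} → x ∼ y → y ∼ x
    ∼sym {x} {y} p = resp (begin
        (x ⁻¹ ∙ y) ⁻¹   ≈⟨ ⁻¹-anti-homo-∙ (x ⁻¹) y ⟩
        y ⁻¹ ∙ x ⁻¹ ⁻¹  ≈⟨ ∙-congˡ (⁻¹-involutive x) ⟩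
        y ⁻¹ ∙ x ∎) (⁻¹∈ p)
    ∼trans : ∀ {x y z} → x ∼ y → y ∼ z → x ∼ z
    ∼trans {x} {y} {z} p q = resp (begin
        x ⁻¹ ∙ y ∙ (y ⁻¹ ∙ z)   ≈⟨ assoc (x ⁻¹) y (y ⁻¹ ∙ z) ⟩
        x ⁻¹ ∙ (y ∙ (y ⁻¹ ∙ z)) ≈⟨ ∙-congˡ (sym (assoc y (y ⁻¹) z)) ⟩
        x ⁻¹ ∙ (y ∙ y ⁻¹ ∙ z)   ≈⟨ ∙-congˡ (∙-congʳ (inverseʳ y)) ⟩
        x ⁻¹ ∙ (ε ∙ z)          ≈⟨ ∙-congˡ (identityˡ z) ⟩
        x ⁻¹ ∙ z ∎) (∙∈ p q)
    ∼∙ : ∀ {x y u v} → x ∼ y → u ∼ v → (x ∙ u) ∼ (y ∙ v)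
    ∼∙ {x} {y} {u} {v} p q = resp (begin
        u ⁻¹ ∙ (x ⁻¹ ∙ y) ∙ u ∙ (u ⁻¹ ∙ v)   ≈⟨ assoc _ u (u ⁻¹ ∙ v) ⟩
        u ⁻¹ ∙ (x ⁻¹ ∙ y) ∙ (u ∙ (u ⁻¹ ∙ v)) ≈⟨ ∙-congˡ (sym (assoc u (u ⁻¹) v)) ⟩
        u ⁻¹ ∙ (x ⁻¹ ∙ y) ∙ (u ∙ u ⁻¹ ∙ v)   ≈⟨ ∙-congˡ (∙-congʳ (inverseʳ u)) ⟩
        u ⁻¹ ∙ (x ⁻¹ ∙ y) ∙ (ε ∙ v)          ≈⟨ ∙-congˡ (identityˡ v) ⟩
        u ⁻¹ ∙ (x ⁻¹ ∙ y) ∙ v                ≈⟨ assoc (u ⁻¹) (x ⁻¹ ∙ y) v ⟩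
        u ⁻¹ ∙ (x ⁻¹ ∙ y ∙ v)                ≈⟨ ∙-congˡ (assoc (x ⁻¹) y v) ⟩
        u ⁻¹ ∙ (x ⁻¹ ∙ (y ∙ v))              ≈⟨ sym (assoc (u ⁻¹) (x ⁻¹) (y ∙ v)) ⟩
        u ⁻¹ ∙ x ⁻¹ ∙ (y ∙ v)                ≈⟨ ∙-congʳ (sym (⁻¹-anti-homo-∙ x u)) ⟩
        (x ∙ u) ⁻¹ ∙ (y ∙ v) ∎) (∙∈ (nN (x ⁻¹ ∙ y) u p) q)
    ∼⁻¹ : ∀ {x y} → x ∼ y → (x ⁻¹) ∼ (y ⁻¹)
    ∼⁻¹ {x} {y} p = resp (begin
        x ⁻¹ ⁻¹ ∙ (x ⁻¹ ∙ y) ⁻¹ ∙ x ⁻¹     ≈⟨ ∙-congʳ (∙-cong (⁻¹-involutive x) (⁻¹-anti-homo-∙ (x ⁻¹) y)) ⟩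
        x ∙ (y ⁻¹ ∙ x ⁻¹ ⁻¹) ∙ x ⁻¹         ≈⟨ ∙-congʳ (∙-congˡ (∙-congˡ (⁻¹-involutive x))) ⟩
        x ∙ (y ⁻¹ ∙ x) ∙ x ⁻¹               ≈⟨ assoc x (y ⁻¹ ∙ x) (x ⁻¹) ⟩
        x ∙ (y ⁻¹ ∙ x ∙ x ⁻¹)               ≈⟨ ∙-congˡ (assoc (y ⁻¹) x (x ⁻¹)) ⟩
        x ∙ (y ⁻¹ ∙ (x ∙ x ⁻¹))             ≈⟨ ∙-congˡ (∙-congˡ (inverseʳ x)) ⟩
        x ∙ (y ⁻¹ ∙ ε)                      ≈⟨ ∙-congˡ (identityʳ (y ⁻¹)) ⟩
        x ∙ y ⁻¹                            ≈⟨ ∙-congʳ (sym (⁻¹-involutive x)) ⟩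
        x ⁻¹ ⁻¹ ∙ y ⁻¹ ∎) (nN _ (x ⁻¹) (⁻¹∈ p))

  central⇒normal : (N : Pred Carrier ℓS) → IsSubgroup N →
                   (∀ a → N a → InCenter a) → IsNormal N
  central⇒normal N sN cen a g p = resp (sym (begin
      g ⁻¹ ∙ a ∙ g    ≈⟨ assoc (g ⁻¹) a g ⟩
      g ⁻¹ ∙ (a ∙ g)  ≈⟨ ∙-congˡ (cen a p g) ⟩
      g ⁻¹ ∙ (g ∙ a)  ≈⟨ sym (assoc (g ⁻¹) g a) ⟩
      g ⁻¹ ∙ g ∙ a    ≈⟨ ∙-congʳ (inverseˡ g) ⟩
      ε ∙ a           ≈⟨ identityˡ a ⟩
      a ∎)) p
    where open IsSubgroup sN
          open SetoidR setoid

_≅_ : Group c ℓ → Group c′ ℓ′ → Set (c ⊔ ℓ ⊔ c′ ⊔ ℓ′)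
G ≅ H = Σ (Group.Carrier G → Group.Carrier H)
          (GroupMorphisms.IsGroupIsomorphism (Group.rawGroup G) (Group.rawGroup H))

IsHom : (G : Group c ℓ) (H : Group c′ ℓ′) → (Group.Carrier G → Group.Carrier H) → Set _
IsHom G H = GroupMorphisms.IsGroupHomomorphism (Group.rawGroup G) (Group.rawGroup H)

_⊗_ : Group c ℓ → Group c′ ℓ′ → Group (c ⊔ c′) (ℓ ⊔ ℓ′)
_⊗_ = DP.group

-- Groups given by generators and relations.
-- (G , g) is presented by generators indexed by I subject to the
-- relations R iff the generators satisfy R in G, and for every group H
-- (of the same universe levels) and every family h in H satisfying R
-- there is exactly one homomorphism G → H sending g i to h i.

IsPresentedBy : {ℓR : Level} (I : Set) →
  (R : (H : Group c ℓ) → (I → Group.Carrier H) → Set ℓR) →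
  (G : Group c ℓ) → (I → Group.Carrier G) → Set (suc (c ⊔ ℓ) ⊔ ℓR)
IsPresentedBy {c} {ℓ} I R G g =
  R G g ×
  (∀ (H : Group c ℓ) (h : I → Group.Carrier H) → R H h →
     Σ (Group.Carrier G → Group.Carrier H) λ φ →
       IsHom G H φ × (∀ i → Group._≈_ H (φ (g i)) (h i))) ×
  (∀ (H : Group c ℓ) (φ ψ : Group.Carrier G → Group.Carrier H) →
     IsHom G H φ → IsHom G H ψ →
     (∀ i → Group._≈_ H (φ (g i)) (ψ (g i))) →
     ∀ x → Group._≈_ H (φ x) (ψ x))

-- generators  x_1..x_n , y_1..y_n , z
Gens : ℕ → Set
Gens n = Fin n ⊎ Fin n ⊎ ⊤

module _ (H : Group c ℓ) {n : ℕ} (g : Gens n → Group.Carrier H) where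
  open Group H
  xg : Fin n → Carrier
  xg i = g (inj₁ i)
  yg : Fin n → Carrier
  yg i = g (inj₂ (inj₁ i))
  zg : Carrier
  zg = g (inj₂ (inj₂ tt))

  CommRels : ℕ → ℕ → Set ℓ
  CommRels p d =
    (∀ i j → xg i ∙ xg j ≈ xg j ∙ xg i) ×
    (∀ i j → yg i ∙ yg j ≈ yg j ∙ yg i) ×
    (∀ i j → ¬ (i ≡ j) → xg i ∙ yg j ≈ yg j ∙ xg i) ×
    (∀ i → xg i ∙ zg ≈ zg ∙ xg i) ×
    (∀ i → yg i ∙ zg ≈ zg ∙ yg i) ×
    (∀ i → comm H (xg i) (yg i) ≈ pow H zg (p ^ (d ∸ 1)))

  HRels : ℕ → ℕ → Set ℓ
  HRels p d =
    (∀ i → pow H (xg i) p ≈ ε) ×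
    (∀ i → pow H (yg i) p ≈ ε) ×
    pow H zg (p ^ d) ≈ ε ×
    CommRels p d

  -- relations of A(n,d)  (x_1 is the generator with index 0)
  ARels : ℕ → ℕ → Set ℓ
  ARels p d =
    (∀ i → toℕ i ≡ 0 → pow H (xg i) p ≈ zg) ×
    (∀ i → ¬ (toℕ i ≡ 0) → pow H (xg i) p ≈ ε) ×
    (∀ i → pow H (yg i) p ≈ ε) ×
    pow H zg (p ^ d) ≈ ε ×
    CommRels p d

IsH : (p n d : ℕ) → Group c ℓ → Set (suc (c ⊔ ℓ))
IsH p n d G = Σ (Gens n → Group.Carrier G) λ g →
  IsPresentedBy (Gens n) (λ H h → HRels H h p d) G g

IsA : (p n d : ℕ) → Group c ℓ → Set (suc (c ⊔ ℓ))
IsA p n d G = Σ (Gens n → Group.Carrier G) λ g →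
  IsPresentedBy (Gens n) (λ H h → ARels H h p d) G g

-- The two conclusions of the proposition, for G, G′ (the smaller
-- group) and K (= H(1,1)).

CentralProductOf : (G G′ K : Group c ℓ) → Set (suc ℓ ⊔ c)
CentralProductOf {c} {ℓ} G G′ K =
  Σ (Pred (Group.Carrier G) ℓ) λ N₁ → Σ (Pred (Group.Carrier G) ℓ) λ N₂ →
  Σ (IsSubgroup G N₁) λ s₁ → Σ (IsSubgroup G N₂) λ s₂ →
  IsCentralProduct G N₁ N₂ × (subgroup G N₁ s₁ ≅ G′) × (subgroup G N₂ s₂ ≅ K)

QuotientForm : (p : ℕ) (G G′ K : Group c ℓ) → Set (suc ℓ ⊔ c)
QuotientForm {c} {ℓ} p G G′ K =
  Σ (Pred (Group.Carrier (G′ ⊗ K)) ℓ) λ B →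
  Σ (IsSubgroup (G′ ⊗ K) B) λ sB →
  Σ (∀ x → B x → InCenter G′ (proj₁ x) × InCenter K (proj₂ x)) λ cen →
  HasSize (G′ ⊗ K) B p ×
  (G ≅ quotient (G′ ⊗ K) B sB
         (central⇒normal (G′ ⊗ K) B sB
           (λ a Ba g → cen a Ba .proj₁ (proj₁ g) , cen a Ba .proj₂ (proj₂ g))))

{-# OPTIONS --safe #-}
-- Single out an index k₀. Let G′ be generated by the pairs x_j, y_j (j ≠ k₀) together with z, and let
-- K = H(1,1) correspond to x_k₀, y_k₀ and the commutator element w = z^(p^(d-1)). The defining relations
-- give homomorphisms α : G′ → G and β : K → G with commuting images, so (a, v) ↦ α a · β v is a
-- homomorphism G′ × K → G; it kills B = ⟨(w′, w_K⁻¹)⟩, where w′ and w_K are the commutator elements of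
-- G′ and K. Conversely the presentation of G yields φ : G → (G′ × K)/B, sending x_k₀, y_k₀ into K and
-- the other generators into G′, and the two maps are mutually inverse because homomorphisms out of a
-- presented group are determined by the generators. That B has order p and that α and β are injective
-- rests on w′ and w_K having order exactly p, which is read off in an explicit Heisenberg group over ℤ.
-- A(n, d) is handled by the same argument with the twisted relation x_1^p = z.
module Submission where

open import Defs
open import Level using (Level; Lift; lift; lower)
open import Function.Base using (_∘_)
open import Data.Nat as ℕ using (ℕ; zero; suc; _≤_; _<_; _∸_; _^_; _%_; _/_; s≤s)
import Data.Nat.Properties as ℕP
import Data.Nat.DivMod as ℕDM
open import Data.Nat.Divisibility using (_∣_; divides; ∣⇒≤)
open import Data.Nat.Primality using (Prime; ¬prime[0])
open import Data.Integer as ℤ using (ℤ; +_)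
import Data.Integer.Properties as ℤP
open import Data.Integer.Solver using (module +-*-Solver)
open import Data.Fin using (Fin; zero; suc; toℕ; fromℕ<; punchIn; punchOut)
import Data.Fin.Properties as FinP
open import Data.Vec.Functional using (insertAt)
open import Data.Vec.Functional.Properties using (insertAt-lookup; insertAt-punchIn)
open import Data.Bool using (Bool; true; false; if_then_else_)
open import Data.Bool.Properties using (if-float)
open import Data.Sum using (_⊎_; inj₁; inj₂)
open import Data.Unit using (tt)
open import Data.Product using (Σ; ∃; _×_; _,_; proj₁; proj₂)
open import Data.Empty using (⊥-elim)
open import Relation.Nullary using (¬_; yes; no)
open import Relation.Unary using (Pred)
open import Relation.Binary.PropositionalEquality as ≡ using (_≡_; _≗_; cong; cong₂)
open import Algebra.Bundles using (Group)
open import Algebra.Morphism.Structures using (module GroupMorphisms)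
import Algebra.Properties.Group as GroupProperties
import Algebra.Morphism.Construct.Composition as Comp
import Algebra.Morphism.Construct.Identity as Id
import Relation.Binary.Reasoning.Setoid as SetoidReasoning
import Algebra.Solver.Monoid as MonoidSolver

private variable
  c ℓ c′ ℓ′ c″ ℓ″ ℓS : Level

-- Elementary group theory

module GroupTheory (G : Group c ℓ) where
  open Group G
  open GroupProperties G
  open SetoidReasoning setoid

  Commute : Carrier → Carrier → Set ℓ
  Commute g h = g ∙ h ≈ h ∙ g

  pow-cong : ∀ k {g h} → g ≈ h → pow G g k ≈ pow G h k
  pow-cong zero    _   = refl
  pow-cong (suc k) g≈h = ∙-cong g≈h (pow-cong k g≈h)

  pow-≡ : ∀ g {m n} → m ≡ n → pow G g m ≈ pow G g n
  pow-≡ g m≡n = reflexive (cong (pow G g) m≡n)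

  pow-+ : ∀ g m n → pow G g (m ℕ.+ n) ≈ pow G g m ∙ pow G g n
  pow-+ g zero    n = sym (identityˡ _)
  pow-+ g (suc m) n = trans (∙-congˡ (pow-+ g m n)) (sym (assoc _ _ _))

  pow-* : ∀ g m n → pow G g (m ℕ.* n) ≈ pow G (pow G g n) m
  pow-* g zero    n = refl
  pow-* g (suc m) n = trans (pow-+ g n (m ℕ.* n)) (∙-congˡ (pow-* g m n))

  ε-pow : ∀ k → pow G ε k ≈ ε
  ε-pow zero    = refl
  ε-pow (suc k) = trans (identityˡ _) (ε-pow k)

  commute-pow : ∀ {g h} k → Commute g h → Commute g (pow G h k)
  commute-pow zero    _  = trans (identityʳ _) (sym (identityˡ _))
  commute-pow {g} {h} (suc k) gh≈hg = begin
    g ∙ (h ∙ pow G h k)  ≈⟨ assoc _ _ _ ⟨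
    g ∙ h ∙ pow G h k    ≈⟨ ∙-congʳ gh≈hg ⟩
    h ∙ g ∙ pow G h k    ≈⟨ assoc _ _ _ ⟩
    h ∙ (g ∙ pow G h k)  ≈⟨ ∙-congˡ (commute-pow k gh≈hg) ⟩
    h ∙ (pow G h k ∙ g)  ≈⟨ assoc _ _ _ ⟨
    h ∙ pow G h k ∙ g    ∎

  commute-⁻¹ : ∀ {g h} → Commute g h → Commute g (h ⁻¹)
  commute-⁻¹ {g} {h} gh≈hg = begin
    g ∙ h ⁻¹                ≈⟨ \\-leftDividesʳ h (g ∙ h ⁻¹) ⟨
    h ⁻¹ ∙ (h ∙ (g ∙ h ⁻¹)) ≈⟨ ∙-congˡ (assoc _ _ _) ⟨
    h ⁻¹ ∙ (h ∙ g ∙ h ⁻¹)   ≈⟨ ∙-congˡ (∙-congʳ gh≈hg) ⟨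
    h ⁻¹ ∙ (g ∙ h ∙ h ⁻¹)   ≈⟨ ∙-congˡ (//-rightDividesʳ h g) ⟩
    h ⁻¹ ∙ g                ∎

  comm-cong : ∀ {a a′ b b′} → a ≈ a′ → b ≈ b′ → comm G a b ≈ comm G a′ b′
  comm-cong a≈a′ b≈b′ = ∙-cong (∙-cong (∙-cong (⁻¹-cong a≈a′) (⁻¹-cong b≈b′)) a≈a′) b≈b′

  commute-resp : ∀ {a a′ b b′} → a ≈ a′ → b ≈ b′ → Commute a′ b′ → Commute a b
  commute-resp a≈a′ b≈b′ a′b′≈b′a′ =
    trans (∙-cong a≈a′ b≈b′) (trans a′b′≈b′a′ (sym (∙-cong b≈b′ a≈a′)))

  x⁻¹∙y≈ε⇒x≈y : ∀ {x y} → x ⁻¹ ∙ y ≈ ε → x ≈ y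
  x⁻¹∙y≈ε⇒x≈y {x} {y} x⁻¹y≈ε = sym (trans (inverseʳ-unique (x ⁻¹) y x⁻¹y≈ε) (⁻¹-involutive x))

  pow-⁻¹ : ∀ g k → pow G (g ⁻¹) k ≈ pow G g k ⁻¹
  pow-⁻¹ g zero    = sym ε⁻¹≈ε
  pow-⁻¹ g (suc k) = begin
    g ⁻¹ ∙ pow G (g ⁻¹) k  ≈⟨ ∙-congˡ (pow-⁻¹ g k) ⟩
    g ⁻¹ ∙ pow G g k ⁻¹    ≈⟨ ⁻¹-anti-homo-∙ _ _ ⟨
    (pow G g k ∙ g) ⁻¹     ≈⟨ ⁻¹-cong (commute-pow k refl) ⟨
    (g ∙ pow G g k) ⁻¹     ∎

  ⟨_⟩ : Carrier → Pred Carrier ℓ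
  ⟨ g ⟩ x = ∃ λ k → x ≈ pow G g k

  pow-central : ∀ {g} k → InCenter G g → InCenter G (pow G g k)
  pow-central k g-central h = sym (commute-pow k (sym (g-central h)))

  ⁻¹-central : ∀ {g} → InCenter G g → InCenter G (g ⁻¹)
  ⁻¹-central g-central h = sym (commute-⁻¹ (sym (g-central h)))

  ⟨⟩-central : ∀ {g} → InCenter G g → ∀ x → ⟨ g ⟩ x → InCenter G x
  ⟨⟩-central g-central x (k , x≈gᵏ) h =
    trans (∙-congʳ x≈gᵏ) (trans (pow-central k g-central h) (∙-congˡ (sym x≈gᵏ)))

  conj : Carrier → Carrier → Carrier
  conj a x = a ⁻¹ ∙ x ∙ a

  commute⇒conj≈ : ∀ {a x} → Commute x a → conj a x ≈ x
  commute⇒conj≈ {a} {x} xa≈ax = begin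
    a ⁻¹ ∙ x ∙ a    ≈⟨ assoc _ _ _ ⟩
    a ⁻¹ ∙ (x ∙ a)  ≈⟨ ∙-congˡ xa≈ax ⟩
    a ⁻¹ ∙ (a ∙ x)  ≈⟨ \\-leftDividesʳ a x ⟩
    x               ∎

  conj≈⇒commute : ∀ {a x} → conj a x ≈ x → Commute x a
  conj≈⇒commute {a} {x} conj≈x = begin
    x ∙ a                ≈⟨ \\-leftDividesˡ a (x ∙ a) ⟨
    a ∙ (a ⁻¹ ∙ (x ∙ a)) ≈⟨ ∙-congˡ (assoc _ _ _) ⟨
    a ∙ conj a x         ≈⟨ ∙-congˡ conj≈x ⟩
    a ∙ x                ∎

  module FiniteOrder {n : ℕ} (g : Carrier) (g^[1+n]≈ε : pow G g (suc n) ≈ ε) where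

    pow-∣ : ∀ {k} → suc n ∣ k → pow G g k ≈ ε
    pow-∣ (divides q ≡.refl) = trans (pow-* g q (suc n)) (trans (pow-cong q g^[1+n]≈ε) (ε-pow q))

    pow-⁻¹≈pow : ∀ k → pow G g k ⁻¹ ≈ pow G g (k ℕ.* n)
    pow-⁻¹≈pow k = sym (inverseʳ-unique _ _ (begin
      pow G g k ∙ pow G g (k ℕ.* n)  ≈⟨ pow-+ g k (k ℕ.* n) ⟨
      pow G g (k ℕ.+ k ℕ.* n)        ≈⟨ pow-≡ g (ℕP.*-suc k n) ⟨
      pow G g (k ℕ.* suc n)          ≈⟨ pow-∣ (divides k ≡.refl) ⟩
      ε                              ∎))

    pow-% : ∀ k → pow G g k ≈ pow G g (k % suc n)
    pow-% k = begin
      pow G g k                                     ≈⟨ pow-≡ g (ℕDM.m≡m%n+[m/n]*n k (suc n)) ⟩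
      pow G g (k % suc n ℕ.+ k / suc n ℕ.* suc n)   ≈⟨ pow-+ g (k % suc n) (k / suc n ℕ.* suc n) ⟩
      pow G g (k % suc n) ∙ pow G g (k / suc n ℕ.* suc n)
        ≈⟨ ∙-congˡ (pow-∣ (divides (k / suc n) ≡.refl)) ⟩
      pow G g (k % suc n) ∙ ε                       ≈⟨ identityʳ _ ⟩
      pow G g (k % suc n)                           ∎

    ⟨g⟩-isSubgroup : IsSubgroup G ⟨ g ⟩
    ⟨g⟩-isSubgroup = record
      { resp = λ { x≈y (k , x≈gᵏ) → k , trans (sym x≈y) x≈gᵏ }
      ; ε∈   = 0 , refl
      ; ∙∈   = λ { (k , x≈gᵏ) (l , y≈gˡ) → k ℕ.+ l , trans (∙-cong x≈gᵏ y≈gˡ) (sym (pow-+ g k l)) }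
      ; ⁻¹∈  = λ { (k , x≈gᵏ) → k ℕ.* n , trans (⁻¹-cong x≈gᵏ) (pow-⁻¹≈pow k) }
      }

    module ExactOrder (order : ∀ k → pow G g k ≈ ε → suc n ∣ k) where

      pow-injective-≤ : ∀ {a b} → a ≤ b → b < suc n → pow G g a ≈ pow G g b → a ≡ b
      pow-injective-≤ {a} {b} a≤b b<1+n gᵃ≈gᵇ =
        ℕP.≤-antisym a≤b (ℕP.m∸n≡0⇒m≤n
          (divisor-below⇒0 (ℕP.≤-<-trans (ℕP.m∸n≤m b a) b<1+n) (order (b ∸ a) g^[b∸a]≈ε)))
        where
        divisor-below⇒0 : ∀ {k} → k < suc n → suc n ∣ k → k ≡ 0
        divisor-below⇒0 {zero}  _     _   = ≡.refl
        divisor-below⇒0 {suc k} k<1+n 1+n∣k = ⊥-elim (ℕP.<⇒≱ k<1+n (∣⇒≤ 1+n∣k))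
        g^[b∸a]≈ε : pow G g (b ∸ a) ≈ ε
        g^[b∸a]≈ε = ∙-cancelˡ (pow G g a) _ _ (begin
          pow G g a ∙ pow G g (b ∸ a)  ≈⟨ pow-+ g a (b ∸ a) ⟨
          pow G g (a ℕ.+ (b ∸ a))      ≈⟨ pow-≡ g (ℕP.m+[n∸m]≡n a≤b) ⟩
          pow G g b                    ≈⟨ gᵃ≈gᵇ ⟨
          pow G g a                    ≈⟨ identityʳ _ ⟨
          pow G g a ∙ ε                ∎)

      pow-injective : ∀ {a b} → a < suc n → b < suc n → pow G g a ≈ pow G g b → a ≡ b
      pow-injective {a} {b} a<1+n b<1+n gᵃ≈gᵇ with ℕP.≤-total a b
      ... | inj₁ a≤b = pow-injective-≤ a≤b b<1+n gᵃ≈gᵇ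
      ... | inj₂ b≤a = ≡.sym (pow-injective-≤ b≤a a<1+n (sym gᵃ≈gᵇ))

      ⟨g⟩-hasSize : HasSize G ⟨ g ⟩ (suc n)
      ⟨g⟩-hasSize =
        (λ i → pow G g (toℕ i)) , (λ i → toℕ i , refl) ,
        (λ i j gⁱ≈gʲ → FinP.toℕ-injective (pow-injective (FinP.toℕ<n i) (FinP.toℕ<n j) gⁱ≈gʲ)) ,
        λ { x (k , x≈gᵏ) → fromℕ< (ℕDM.m%n<n k (suc n)) ,
              trans x≈gᵏ (trans (pow-% k) (pow-≡ g (≡.sym (FinP.toℕ-fromℕ< (ℕDM.m%n<n k (suc n)))))) }

module _ {G : Group c ℓ} {H : Group c′ ℓ′} where
  private
    module G = Group G
    module H = Group H
  open GroupProperties H using (∙-cancelˡ; inverseˡ-unique)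

  ∙-homo⇒isHom : (f : G.Carrier → H.Carrier) → (∀ {x y} → x G.≈ y → f x H.≈ f y) →
                 (∀ x y → f (x G.∙ y) H.≈ f x H.∙ f y) → IsHom G H f
  ∙-homo⇒isHom f f-cong ∙-homo = record
    { isMonoidHomomorphism = record
      { isMagmaHomomorphism = record { isRelHomomorphism = record { cong = f-cong } ; homo = ∙-homo }
      ; ε-homo = ε-homo }
    ; ⁻¹-homo = λ x → inverseˡ-unique _ _ (H.trans (H.sym (∙-homo (x G.⁻¹) x)) (H.trans (f-cong (G.inverseˡ x)) ε-homo))
    }
    where
    ε-homo : f G.ε H.≈ H.ε
    ε-homo = ∙-cancelˡ (f G.ε) _ _
      (H.trans (H.sym (∙-homo G.ε G.ε)) (H.trans (f-cong (G.identityˡ G.ε)) (H.sym (H.identityʳ (f G.ε)))))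

  comm-homo : ∀ {f} → IsHom G H f → ∀ a b → f (comm G a b) H.≈ comm H (f a) (f b)
  comm-homo {f} f-hom a b = H.trans (homo _ b) (H.∙-congʳ (H.trans (homo _ a) (H.∙-congʳ
    (H.trans (homo (a G.⁻¹) (b G.⁻¹)) (H.∙-cong (⁻¹-homo a) (⁻¹-homo b))))))
    where open GroupMorphisms.IsGroupHomomorphism f-hom

  inverse-homs⇒≅ : (φ : G.Carrier → H.Carrier) (ψ : H.Carrier → G.Carrier) → IsHom G H φ →
                   (∀ {x y} → x H.≈ y → ψ x G.≈ ψ y) → (∀ a → ψ (φ a) G.≈ a) → (∀ x → φ (ψ x) H.≈ x) → G ≅ H
  inverse-homs⇒≅ φ ψ φ-hom ψ-cong ψφ≈id φψ≈id = φ , record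
    { isGroupMonomorphism = record
      { isGroupHomomorphism = φ-hom
      ; injective = λ {a} {b} φa≈φb → G.trans (G.sym (ψφ≈id a)) (G.trans (ψ-cong φa≈φb) (ψφ≈id b)) }
    ; surjective = λ x → ψ x , λ y≈ψx → H.trans (⟦⟧-cong y≈ψx) (φψ≈id x)
    }
    where open GroupMorphisms.IsGroupHomomorphism φ-hom

  commute-homo : ∀ {f a b} → IsHom G H f → GroupTheory.Commute G a b → GroupTheory.Commute H (f a) (f b)
  commute-homo {f} {a} {b} f-hom ab≈ba = H.trans (H.sym (homo a b)) (H.trans (⟦⟧-cong ab≈ba) (homo b a))
    where open GroupMorphisms.IsGroupHomomorphism f-hom

  pow-homo : ∀ {f} → IsHom G H f → ∀ g k → f (pow G g k) H.≈ pow H (f g) k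
  pow-homo f-hom g zero    = ε-homo where open GroupMorphisms.IsGroupHomomorphism f-hom
  pow-homo f-hom g (suc k) = H.trans (homo g (pow G g k)) (H.∙-congˡ (pow-homo f-hom g k))
    where open GroupMorphisms.IsGroupHomomorphism f-hom

conj-isHom : (G : Group c ℓ) (a : Group.Carrier G) → IsHom G G (GroupTheory.conj G a)
conj-isHom G a = ∙-homo⇒isHom {G = G} {H = G} (conj a) (λ x≈y → ∙-congʳ (∙-congˡ x≈y)) λ x y → begin
  a ⁻¹ ∙ (x ∙ y) ∙ a                  ≈⟨ ∙-congʳ (∙-congˡ (∙-congʳ (identityʳ x))) ⟨
  a ⁻¹ ∙ (x ∙ ε ∙ y) ∙ a              ≈⟨ ∙-congʳ (∙-congˡ (∙-congʳ (∙-congˡ (inverseʳ a)))) ⟨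
  a ⁻¹ ∙ (x ∙ (a ∙ a ⁻¹) ∙ y) ∙ a
    ≈⟨ solve 4 (λ a′ x a y → (a′ ⊕ ((x ⊕ (a ⊕ a′)) ⊕ y)) ⊕ a ⊜ ((a′ ⊕ x) ⊕ a) ⊕ ((a′ ⊕ y) ⊕ a)) refl (a ⁻¹) x a y ⟩
  a ⁻¹ ∙ x ∙ a ∙ (a ⁻¹ ∙ y ∙ a)       ∎
  where open Group G
        open GroupTheory G using (conj)
        open SetoidReasoning setoid
        open MonoidSolver monoid using (solve; _⊜_; _⊕_)

module _ {G : Group c ℓ} {H : Group c′ ℓ′} where
  private
    module G = Group G
    module H = Group H

  preimage-isSubgroup : ∀ {f} {N : Pred H.Carrier ℓS} → IsHom G H f → IsSubgroup H N → IsSubgroup G (N ∘ f)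
  preimage-isSubgroup f-hom N-sub = record
    { resp = λ x≈y → resp (⟦⟧-cong x≈y)
    ; ε∈   = resp (H.sym ε-homo) ε∈
    ; ∙∈   = λ {x} {y} Nfx Nfy → resp (H.sym (homo x y)) (∙∈ Nfx Nfy)
    ; ⁻¹∈  = λ {x} Nfx → resp (H.sym (⁻¹-homo x)) (⁻¹∈ Nfx)
    }
    where open IsSubgroup N-sub
          open GroupMorphisms.IsGroupHomomorphism f-hom

  proj₁-isHom : IsHom (G ⊗ H) G proj₁
  proj₁-isHom = ∙-homo⇒isHom {G = G ⊗ H} {H = G} proj₁ proj₁ (λ _ _ → G.refl)

  proj₂-isHom : IsHom (G ⊗ H) H proj₂
  proj₂-isHom = ∙-homo⇒isHom {G = G ⊗ H} {H = H} proj₂ proj₂ (λ _ _ → H.refl)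

  inj₁-isHom : IsHom G (G ⊗ H) (λ a → a , H.ε)
  inj₁-isHom = ∙-homo⇒isHom {G = G} {H = G ⊗ H} _ (λ a≈b → a≈b , H.refl) (λ _ _ → G.refl , H.sym (H.identityˡ H.ε))

  inj₂-isHom : IsHom H (G ⊗ H) (λ b → G.ε , b)
  inj₂-isHom = ∙-homo⇒isHom {G = H} {H = G ⊗ H} _ (λ a≈b → G.refl , a≈b) (λ _ _ → G.sym (G.identityˡ G.ε) , H.refl)

  ⊗-central : ∀ {a b} → InCenter G a → InCenter H b → InCenter (G ⊗ H) (a , b)
  ⊗-central a-central b-central (u , v) = a-central u , b-central v

  central-components : ∀ {a b} → InCenter (G ⊗ H) (a , b) → InCenter G a × InCenter H b
  central-components ab-central = (λ u → proj₁ (ab-central (u , H.ε))) , (λ v → proj₂ (ab-central (G.ε , v)))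

  module _ {K : Group c″ ℓ″} {α β} (α-hom : IsHom G K α) (β-hom : IsHom H K β) where
    private module K = Group K
    open SetoidReasoning K.setoid
    open MonoidSolver K.monoid using (solve; _⊜_; _⊕_)
    private
      module α = GroupMorphisms.IsGroupHomomorphism α-hom
      module β = GroupMorphisms.IsGroupHomomorphism β-hom

    commuting-product-isHom : (∀ a b → α a K.∙ β b K.≈ β b K.∙ α a) →
                              IsHom (G ⊗ H) K (λ q → α (proj₁ q) K.∙ β (proj₂ q))
    commuting-product-isHom αβ≈βα = ∙-homo⇒isHom {G = G ⊗ H} {H = K} _
      (λ (a≈a′ , b≈b′) → K.∙-cong (α.⟦⟧-cong a≈a′) (β.⟦⟧-cong b≈b′)) λ (a , b) (a′ , b′) → begin
        α (a G.∙ a′) K.∙ β (b H.∙ b′)        ≈⟨ K.∙-cong (α.homo a a′) (β.homo b b′) ⟩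
        α a K.∙ α a′ K.∙ (β b K.∙ β b′)      ≈⟨ reassoc (α a) (α a′) (β b) (β b′) ⟩
        α a K.∙ (α a′ K.∙ β b) K.∙ β b′      ≈⟨ K.∙-congʳ (K.∙-congˡ (αβ≈βα a′ b)) ⟩
        α a K.∙ (β b K.∙ α a′) K.∙ β b′      ≈⟨ reassoc (α a) (β b) (α a′) (β b′) ⟨
        α a K.∙ β b K.∙ (α a′ K.∙ β b′)      ∎
      where
      reassoc : ∀ u v w x → u K.∙ v K.∙ (w K.∙ x) K.≈ u K.∙ (v K.∙ w) K.∙ x
      reassoc = solve 4 (λ u v w x → (u ⊕ v) ⊕ (w ⊕ x) ⊜ (u ⊕ (v ⊕ w)) ⊕ x) K.refl

module Quotient (P : Group c ℓ) {B : Pred (Group.Carrier P) ℓS}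
                (B-sub : IsSubgroup P B) (B-normal : IsNormal P B) where
  open Group P
  open GroupProperties P using (\\-leftDividesˡ)
  open IsSubgroup B-sub
  private
    Q = quotient P B B-sub B-normal
    module Q = Group Q

  ≈⇒∼ : ∀ {x y} → x ≈ y → x Q.≈ y
  ≈⇒∼ {x} x≈y = resp (trans (sym (inverseˡ x)) (∙-congˡ x≈y)) ε∈

  quotient-map-isHom : IsHom P Q (λ x → x)
  quotient-map-isHom = ∙-homo⇒isHom {G = P} {H = Q} _ ≈⇒∼ (λ _ _ → Q.refl)

  quotient-isSubgroup : ∀ {S : Pred Carrier ℓS} → IsSubgroup P S → (∀ x → B x → S x) → IsSubgroup Q S
  quotient-isSubgroup S-sub B⊆S = record
    { resp = λ {x} {y} x∼y Sx → S.resp (\\-leftDividesˡ x y) (S.∙∈ Sx (B⊆S _ x∼y))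
    ; ε∈   = S.ε∈
    ; ∙∈   = S.∙∈
    ; ⁻¹∈  = S.⁻¹∈
    }
    where module S = IsSubgroup S-sub

  quotient-lift-isHom : ∀ {H : Group c′ ℓ′} {f} → IsHom P H f → (∀ x → B x → Group._≈_ H (f x) (Group.ε H)) →
                        IsHom Q H f
  quotient-lift-isHom {H = H} {f} f-hom f[B]≈ε = ∙-homo⇒isHom {G = Q} {H = H} f f-cong homo
    where
    open GroupMorphisms.IsGroupHomomorphism f-hom
    module H = Group H
    open SetoidReasoning H.setoid
    f-cong : ∀ {x y} → x Q.≈ y → f x H.≈ f y
    f-cong {x} {y} x∼y = begin
      f x                   ≈⟨ H.identityʳ (f x) ⟨
      f x H.∙ H.ε           ≈⟨ H.∙-congˡ (f[B]≈ε _ x∼y) ⟨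
      f x H.∙ f (x ⁻¹ ∙ y)  ≈⟨ homo x (x ⁻¹ ∙ y) ⟨
      f (x ∙ (x ⁻¹ ∙ y))    ≈⟨ ⟦⟧-cong (\\-leftDividesˡ x y) ⟩
      f y                   ∎

module _ {G : Group c ℓ} {H : Group c′ ℓ′} {α} (α-hom : IsHom H G α)
         (α-injective : ∀ {a b} → Group._≈_ G (α a) (α b) → Group._≈_ H a b)
         {N : Pred (Group.Carrier G) ℓS} (N-sub : IsSubgroup G N) (α∈N : ∀ a → N (α a))
         (preimage : Σ (Group.Carrier G) N → Group.Carrier H)
         (α∘preimage : ∀ x → Group._≈_ G (α (preimage x)) (proj₁ x)) where
  private
    module G = Group G
    module H = Group H
    open GroupMorphisms.IsGroupHomomorphism α-hom

  image-subgroup≅domain : subgroup G N N-sub ≅ H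
  image-subgroup≅domain = preimage , record
    { isGroupMonomorphism = record
      { isGroupHomomorphism = ∙-homo⇒isHom {G = subgroup G N N-sub} {H = H} preimage
          (λ {x} {y} x≈y → α-injective (G.trans (α∘preimage x) (G.trans x≈y (G.sym (α∘preimage y)))))
          (λ x y → α-injective (G.trans (α∘preimage _)
                     (G.sym (G.trans (homo (preimage x) (preimage y)) (G.∙-cong (α∘preimage x) (α∘preimage y))))))
      ; injective = λ {x} {y} preimage≈ → G.trans (G.sym (α∘preimage x)) (G.trans (⟦⟧-cong preimage≈) (α∘preimage y))
      }
    ; surjective = λ a → (α a , α∈N a) , λ {x} x≈αa → α-injective (G.trans (α∘preimage x) x≈αa)
    }

-- Presented groups

module Presentation {ℓR} {I : Set} {R : (H : Group c ℓ) → (I → Group.Carrier H) → Set ℓR}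
                    {G : Group c ℓ} {g : I → Group.Carrier G} (pr : IsPresentedBy I R G g) where

  relations : R G g
  relations = proj₁ pr

  induced-hom : (H : Group c ℓ) (h : I → Group.Carrier H) → R H h →
                Σ (Group.Carrier G → Group.Carrier H) λ f → IsHom G H f × (∀ i → Group._≈_ H (f (g i)) (h i))
  induced-hom = proj₁ (proj₂ pr)

  hom-ext : (H : Group c ℓ) {f f′ : Group.Carrier G → Group.Carrier H} → IsHom G H f → IsHom G H f′ →
            (∀ i → Group._≈_ H (f (g i)) (f′ (g i))) → ∀ x → Group._≈_ H (f x) (f′ x)
  hom-ext H = proj₂ (proj₂ pr) H _ _

  commute-image : (H : Group c ℓ) {f : Group.Carrier G → Group.Carrier H} → IsHom G H f →
                  ∀ a → (∀ i → GroupTheory.Commute H a (f (g i))) → ∀ x → GroupTheory.Commute H a (f x)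
  commute-image H {f} f-hom a a-commutes x = H.sym (conj≈⇒commute (H.sym
      (hom-ext H f-hom (Comp.isGroupHomomorphism H.trans f-hom (conj-isHom H a))
        (λ i → H.sym (commute⇒conj≈ (H.sym (a-commutes i)))) x)))
    where module H = Group H
          open GroupTheory H using (commute⇒conj≈; conj≈⇒commute)

isPresentedBy-resp : ∀ {ℓR ℓR′} {I : Set} {R : (H : Group c ℓ) → (I → Group.Carrier H) → Set ℓR}
                     {R′ : (H : Group c ℓ) → (I → Group.Carrier H) → Set ℓR′} →
                     (∀ H h → R H h → R′ H h) → (∀ H h → R′ H h → R H h) →
                     ∀ {G g} → IsPresentedBy I R G g → IsPresentedBy I R′ G g
isPresentedBy-resp R⇒R′ R′⇒R {G} {g} (rel , induced , ext) =
  R⇒R′ G g rel , (λ H h → induced H h ∘ R′⇒R H h) , ext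

untwisted : ∀ {n} → Fin n → Bool
untwisted _ = false

isFirst : ∀ {n} → Fin n → Bool
isFirst zero    = true
isFirst (suc _) = false

module _ (H : Group c ℓ) {n : ℕ} (g : Gens n → Group.Carrier H) where
  open Group H
  open GroupTheory H using (Commute)

  -- The relations of H(n, d) (twist untwisted) and of A(n, d) (twist isFirst) at once.
  record TwistedRels (t : Fin n → Bool) (p d : ℕ) : Set ℓ where
    field
      x-pow   : ∀ i → pow H (xg H g i) p ≈ (if t i then zg H g else ε)
      y-pow   : ∀ i → pow H (yg H g i) p ≈ ε
      z-pow   : pow H (zg H g) (p ^ d) ≈ ε
      x-x     : ∀ i j → Commute (xg H g i) (xg H g j)
      y-y     : ∀ i j → Commute (yg H g i) (yg H g j)
      x-y     : ∀ i j → ¬ i ≡ j → Commute (xg H g i) (yg H g j)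
      x-z     : ∀ i → Commute (xg H g i) (zg H g)
      y-z     : ∀ i → Commute (yg H g i) (zg H g)
      [x,y]≈z : ∀ i → comm H (xg H g i) (yg H g i) ≈ pow H (zg H g) (p ^ (d ∸ 1))

  module _ {p d : ℕ} where

    HRels⇒TwistedRels : HRels H g p d → TwistedRels untwisted p d
    HRels⇒TwistedRels (x-pow , y-pow , z-pow , x-x , y-y , x-y , x-z , y-z , [x,y]≈z) =
      record { x-pow = x-pow ; y-pow = y-pow ; z-pow = z-pow ; x-x = x-x ; y-y = y-y ; x-y = x-y
             ; x-z = x-z ; y-z = y-z ; [x,y]≈z = [x,y]≈z }

    TwistedRels⇒HRels : TwistedRels untwisted p d → HRels H g p d
    TwistedRels⇒HRels r = x-pow , y-pow , z-pow , x-x , y-y , x-y , x-z , y-z , [x,y]≈z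
      where open TwistedRels r

    ARels⇒TwistedRels : ARels H g p d → TwistedRels isFirst p d
    ARels⇒TwistedRels (x₁-pow , xᵢ-pow , y-pow , z-pow , x-x , y-y , x-y , x-z , y-z , [x,y]≈z) =
      record { x-pow = x-pow ; y-pow = y-pow ; z-pow = z-pow ; x-x = x-x ; y-y = y-y ; x-y = x-y
             ; x-z = x-z ; y-z = y-z ; [x,y]≈z = [x,y]≈z }
      where
      x-pow : ∀ i → pow H (xg H g i) p ≈ (if isFirst i then zg H g else ε)
      x-pow zero    = x₁-pow zero ≡.refl
      x-pow (suc i) = xᵢ-pow (suc i) λ ()

    TwistedRels⇒ARels : TwistedRels isFirst p d → ARels H g p d
    TwistedRels⇒ARels r = x₁-pow , xᵢ-pow , y-pow , z-pow , x-x , y-y , x-y , x-z , y-z , [x,y]≈z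
      where
      open TwistedRels r
      x₁-pow : ∀ i → toℕ i ≡ 0 → pow H (xg H g i) p ≈ zg H g
      x₁-pow zero _ = x-pow zero
      xᵢ-pow : ∀ i → ¬ toℕ i ≡ 0 → pow H (xg H g i) p ≈ ε
      xᵢ-pow zero    i≢0 = ⊥-elim (i≢0 ≡.refl)
      xᵢ-pow (suc i) _   = x-pow (suc i)

module _ {p n d : ℕ} {G : Group c ℓ} {g : Gens n → Group.Carrier G} where

  H-twisted : IsPresentedBy (Gens n) (λ H h → HRels H h p d) G g →
              IsPresentedBy (Gens n) (λ H h → TwistedRels H h untwisted p d) G g
  H-twisted = isPresentedBy-resp (λ H h → HRels⇒TwistedRels H h) (λ H h → TwistedRels⇒HRels H h)

  A-twisted : IsPresentedBy (Gens n) (λ H h → ARels H h p d) G g →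
              IsPresentedBy (Gens n) (λ H h → TwistedRels H h isFirst p d) G g
  A-twisted = isPresentedBy-resp (λ H h → ARels⇒TwistedRels H h) (λ H h → TwistedRels⇒ARels H h)

-- A Heisenberg group over ℤ

module IntegerCongruence where
  open +-*-Solver
  open import Data.Integer using (_+_; _*_; -_; ∣_∣)

  infix 4 _≡_[mod_]
  record _≡_[mod_] (a b m : ℤ) : Set where
    constructor _,_
    field
      multiplier : ℤ
      equation : a ≡ b + multiplier * m

  ≡⇒≡[mod] : ∀ {a b m} → a ≡ b → a ≡ b [mod m ]
  ≡⇒≡[mod] {a} {m = m} ≡.refl = + 0 , solve 2 (λ a m → a := a :+ con (+ 0) :* m) ≡.refl a m

  ≡[mod]-refl : ∀ {a m} → a ≡ a [mod m ]
  ≡[mod]-refl = ≡⇒≡[mod] ≡.refl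

  ≡[mod]-sym : ∀ {a b m} → a ≡ b [mod m ] → b ≡ a [mod m ]
  ≡[mod]-sym {b = b} {m} (q , ≡.refl) = - q , solve 3 (λ b q m → b := (b :+ q :* m) :+ (:- q) :* m) ≡.refl b q m

  ≡[mod]-trans : ∀ {a b c m} → a ≡ b [mod m ] → b ≡ c [mod m ] → a ≡ c [mod m ]
  ≡[mod]-trans {c = c} {m} (q , ≡.refl) (r , ≡.refl) =
    q + r , solve 4 (λ c r q m → (c :+ r :* m) :+ q :* m := c :+ (q :+ r) :* m) ≡.refl c r q m

  +-cong-mod : ∀ {a b c d m} → a ≡ b [mod m ] → c ≡ d [mod m ] → a + c ≡ b + d [mod m ]
  +-cong-mod {b = b} {d = d} {m} (q , ≡.refl) (r , ≡.refl) =
    q + r , solve 5 (λ b d q r m → (b :+ q :* m) :+ (d :+ r :* m) := (b :+ d) :+ (q :+ r) :* m) ≡.refl b d q r m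

  neg-cong-mod : ∀ {a b m} → a ≡ b [mod m ] → - a ≡ - b [mod m ]
  neg-cong-mod {b = b} {m} (q , ≡.refl) = - q , solve 3 (λ b q m → :- (b :+ q :* m) := (:- b) :+ (:- q) :* m) ≡.refl b q m

  *-cong-mod : ∀ {a b c d m} → a ≡ b [mod m ] → c ≡ d [mod m ] → a * c ≡ b * d [mod m ]
  *-cong-mod {b = b} {d = d} {m} (q , ≡.refl) (r , ≡.refl) = q * d + b * r + q * r * m ,
    solve 5 (λ b d q r m → (b :+ q :* m) :* (d :+ r :* m) := b :* d :+ (q :* d :+ b :* r :+ q :* r :* m) :* m) ≡.refl b d q r m

  *-≡0-mod : ∀ {m} x → m * x ≡ + 0 [mod m ]
  *-≡0-mod {m} x = x , solve 2 (λ m x → m :* x := con (+ 0) :+ x :* m) ≡.refl m x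

  *-scale-mod : ∀ {a b m} k → a ≡ b [mod m ] → k * a ≡ k * b [mod m * k ]
  *-scale-mod {b = b} {m} k (q , ≡.refl) = q , solve 4 (λ k b q m → k :* (b :+ q :* m) := k :* b :+ q :* (m :* k)) ≡.refl k b q m

  *-cancel-mod : ∀ {k p} n .{{_ : ℕ.NonZero n}} → + k * + n ≡ + 0 [mod + p * + n ] → p ∣ k
  *-cancel-mod {k} {p} n (q , kn≡qpn) = divides ∣ q ∣ (ℕP.*-cancelʳ-≡ k (∣ q ∣ ℕ.* p) n (begin
    k ℕ.* n                      ≡⟨ ℤP.abs-* (+ k) (+ n) ⟨
    ∣ + k * + n ∣                ≡⟨ cong ∣_∣ kn≡qpn ⟩
    ∣ + 0 + q * (+ p * + n) ∣    ≡⟨ cong ∣_∣ (ℤP.+-identityˡ (q * (+ p * + n))) ⟩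
    ∣ q * (+ p * + n) ∣          ≡⟨ ℤP.abs-* q (+ p * + n) ⟩
    ∣ q ∣ ℕ.* ∣ + p * + n ∣      ≡⟨ cong (∣ q ∣ ℕ.*_) (ℤP.abs-* (+ p) (+ n)) ⟩
    ∣ q ∣ ℕ.* (p ℕ.* n)          ≡⟨ ℕP.*-assoc ∣ q ∣ p n ⟨
    ∣ q ∣ ℕ.* p ℕ.* n            ∎))
    where open ≡.≡-Reasoning

module DotProduct where
  open +-*-Solver
  open IntegerCongruence
  open import Data.Integer using (_+_; _*_; -_)

  dot : ∀ {n} → (Fin n → ℤ) → (Fin n → ℤ) → ℤ
  dot {zero}  a b = + 0
  dot {suc n} a b = a zero * b zero + dot (a ∘ suc) (b ∘ suc)

  zeros : ∀ {n} → Fin n → ℤ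
  zeros _ = + 0

  δ : ∀ {n} → Fin n → Fin n → ℤ
  δ zero    zero    = + 1
  δ zero    (suc j) = + 0
  δ (suc i) zero    = + 0
  δ (suc i) (suc j) = δ i j

  dot-cong-mod : ∀ {n m} {a a′ b b′ : Fin n → ℤ} → (∀ j → a j ≡ a′ j [mod m ]) → (∀ j → b j ≡ b′ j [mod m ]) →
                 dot a b ≡ dot a′ b′ [mod m ]
  dot-cong-mod {zero}  a≡a′ b≡b′ = ≡[mod]-refl
  dot-cong-mod {suc n} a≡a′ b≡b′ =
    +-cong-mod (*-cong-mod (a≡a′ zero) (b≡b′ zero)) (dot-cong-mod (a≡a′ ∘ suc) (b≡b′ ∘ suc))

  dot-+ˡ : ∀ {n} (a a′ b : Fin n → ℤ) → dot (λ j → a j + a′ j) b ≡ dot a b + dot a′ b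
  dot-+ˡ {zero}  a a′ b = ≡.refl
  dot-+ˡ {suc n} a a′ b = ≡.trans (cong (λ u → (a zero + a′ zero) * b zero + u) (dot-+ˡ (a ∘ suc) (a′ ∘ suc) (b ∘ suc)))
    (solve 5 (λ x y z u v → (x :+ y) :* z :+ (u :+ v) := (x :* z :+ u) :+ (y :* z :+ v)) ≡.refl (a zero) (a′ zero) (b zero) _ _)

  dot-+ʳ : ∀ {n} (a b b′ : Fin n → ℤ) → dot a (λ j → b j + b′ j) ≡ dot a b + dot a b′
  dot-+ʳ {zero}  a b b′ = ≡.refl
  dot-+ʳ {suc n} a b b′ = ≡.trans (cong (λ u → a zero * (b zero + b′ zero) + u) (dot-+ʳ (a ∘ suc) (b ∘ suc) (b′ ∘ suc)))
    (solve 5 (λ x y z u v → x :* (y :+ z) :+ (u :+ v) := (x :* y :+ u) :+ (x :* z :+ v)) ≡.refl (a zero) (b zero) (b′ zero) _ _)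

  dot-negˡ : ∀ {n} (a b : Fin n → ℤ) → dot (λ j → - a j) b ≡ - dot a b
  dot-negˡ {zero}  a b = ≡.refl
  dot-negˡ {suc n} a b = ≡.trans (cong (λ u → (- a zero) * b zero + u) (dot-negˡ (a ∘ suc) (b ∘ suc)))
    (solve 3 (λ x y u → (:- x) :* y :+ (:- u) := :- (x :* y :+ u)) ≡.refl (a zero) (b zero) _)

  dot-negʳ : ∀ {n} (a b : Fin n → ℤ) → dot a (λ j → - b j) ≡ - dot a b
  dot-negʳ {zero}  a b = ≡.refl
  dot-negʳ {suc n} a b = ≡.trans (cong (λ u → a zero * (- b zero) + u) (dot-negʳ (a ∘ suc) (b ∘ suc)))
    (solve 3 (λ x y u → x :* (:- y) :+ (:- u) := :- (x :* y :+ u)) ≡.refl (a zero) (b zero) _)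

  dot-scaleʳ : ∀ {n} k (a b : Fin n → ℤ) → dot a (λ j → k * b j) ≡ k * dot a b
  dot-scaleʳ {zero}  k a b = ≡.sym (ℤP.*-zeroʳ k)
  dot-scaleʳ {suc n} k a b = ≡.trans (cong (λ u → a zero * (k * b zero) + u) (dot-scaleʳ k (a ∘ suc) (b ∘ suc)))
    (solve 4 (λ k x y u → x :* (k :* y) :+ k :* u := k :* (x :* y :+ u)) ≡.refl k (a zero) (b zero) _)

  dot-zerosˡ : ∀ {n} (b : Fin n → ℤ) → dot zeros b ≡ + 0
  dot-zerosˡ {zero}  b = ≡.refl
  dot-zerosˡ {suc n} b = ≡.trans (ℤP.+-identityˡ _) (dot-zerosˡ (b ∘ suc))

  dot-zerosʳ : ∀ {n} (a : Fin n → ℤ) → dot a zeros ≡ + 0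
  dot-zerosʳ {zero}  a = ≡.refl
  dot-zerosʳ {suc n} a = ≡.trans (cong (_+ dot (a ∘ suc) zeros) (ℤP.*-zeroʳ (a zero)))
    (≡.trans (ℤP.+-identityˡ _) (dot-zerosʳ (a ∘ suc)))

  dot-δ-δ : ∀ {n} (i : Fin n) → dot (δ i) (δ i) ≡ + 1
  dot-δ-δ {suc n} zero = cong (λ u → + 1 + u) (dot-zerosˡ {n} zeros)
  dot-δ-δ {suc n} (suc i) = ≡.trans (ℤP.+-identityˡ _) (dot-δ-δ i)

  dot-δ-δ-≢ : ∀ {n} (i j : Fin n) → ¬ i ≡ j → dot (δ i) (δ j) ≡ + 0
  dot-δ-δ-≢ zero    zero    i≢j = ⊥-elim (i≢j ≡.refl)
  dot-δ-δ-≢ zero    (suc j) _   = ≡.trans (ℤP.+-identityˡ _) (dot-zerosˡ (δ j))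
  dot-δ-δ-≢ (suc i) zero    _   = ≡.trans (ℤP.+-identityˡ _) (dot-zerosʳ (δ i))
  dot-δ-δ-≢ (suc i) (suc j) i≢j = ≡.trans (ℤP.+-identityˡ _) (dot-δ-δ-≢ i j (i≢j ∘ cong suc))

module Heisenberg (P S : ℤ) (m : ℕ) where
  open +-*-Solver
  open IntegerCongruence
  open DotProduct
  open import Data.Integer using (_+_; _*_; -_; _-_)

  -- The Heisenberg group of dimension 2m + 1 with its centre scaled by S; a and b are read modulo P,
  -- the central coordinate z modulo P · S.
  record Element : Set where
    constructor mk
    field
      a b : Fin m → ℤ
      z   : ℤ
  open Element

  infix 4 _≈_
  _≈_ : Element → Element → Set
  x ≈ y = (∀ j → a x j ≡ a y j [mod P ]) × (∀ j → b x j ≡ b y j [mod P ]) × (z x ≡ z y [mod P * S ])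

  infixl 7 _∙_
  _∙_ : Element → Element → Element
  x ∙ y = mk (λ j → a x j + a y j) (λ j → b x j + b y j) (z x + z y + S * dot (a x) (b y))

  e : Element
  e = mk zeros zeros (+ 0)

  _⁻¹ : Element → Element
  x ⁻¹ = mk (λ j → - a x j) (λ j → - b x j) (- z x + S * dot (a x) (b x))

  ≡⇒≈ : ∀ {x y} → a x ≗ a y → b x ≗ b y → z x ≡ z y → x ≈ y
  ≡⇒≈ a≗ b≗ z≡ = ≡⇒≡[mod] ∘ a≗ , ≡⇒≡[mod] ∘ b≗ , ≡⇒≡[mod] z≡

  ≈-refl : ∀ {x} → x ≈ x
  ≈-refl = (λ _ → ≡[mod]-refl) , (λ _ → ≡[mod]-refl) , ≡[mod]-refl

  ≈-sym : ∀ {x y} → x ≈ y → y ≈ x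
  ≈-sym (a≈ , b≈ , c≈) = ≡[mod]-sym ∘ a≈ , ≡[mod]-sym ∘ b≈ , ≡[mod]-sym c≈

  ≈-trans : ∀ {x y z} → x ≈ y → y ≈ z → x ≈ z
  ≈-trans (a≈ , b≈ , c≈) (a≈′ , b≈′ , c≈′) =
    (λ j → ≡[mod]-trans (a≈ j) (a≈′ j)) , (λ j → ≡[mod]-trans (b≈ j) (b≈′ j)) , ≡[mod]-trans c≈ c≈′

  ∙-cong : ∀ {x y u v} → x ≈ y → u ≈ v → x ∙ u ≈ y ∙ v
  ∙-cong (a≈ , b≈ , c≈) (a≈′ , b≈′ , c≈′) =
    (λ j → +-cong-mod (a≈ j) (a≈′ j)) , (λ j → +-cong-mod (b≈ j) (b≈′ j)) ,
    +-cong-mod (+-cong-mod c≈ c≈′) (*-scale-mod S (dot-cong-mod a≈ b≈′))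

  ⁻¹-cong : ∀ {x y} → x ≈ y → x ⁻¹ ≈ y ⁻¹
  ⁻¹-cong (a≈ , b≈ , c≈) =
    neg-cong-mod ∘ a≈ , neg-cong-mod ∘ b≈ , +-cong-mod (neg-cong-mod c≈) (*-scale-mod S (dot-cong-mod a≈ b≈))

  assoc : ∀ x y w → x ∙ y ∙ w ≈ x ∙ (y ∙ w)
  assoc x y w = ≡⇒≈ (λ j → ℤP.+-assoc (a x j) (a y j) (a w j)) (λ j → ℤP.+-assoc (b x j) (b y j) (b w j)) (begin
    z x + z y + S * dot (a x) (b y) + z w + S * dot (λ j → a x j + a y j) (b w)
      ≡⟨ cong (λ u → z x + z y + S * dot (a x) (b y) + z w + S * u) (dot-+ˡ (a x) (a y) (b w)) ⟩
    z x + z y + S * dot (a x) (b y) + z w + S * (dot (a x) (b w) + dot (a y) (b w))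
      ≡⟨ solve 7 (λ cx cy cz s d₁ d₂ d₃ → cx :+ cy :+ s :* d₁ :+ cz :+ s :* (d₂ :+ d₃)
                                        := cx :+ (cy :+ cz :+ s :* d₃) :+ s :* (d₁ :+ d₂))
           ≡.refl (z x) (z y) (z w) S (dot (a x) (b y)) (dot (a x) (b w)) (dot (a y) (b w)) ⟩
    z x + (z y + z w + S * dot (a y) (b w)) + S * (dot (a x) (b y) + dot (a x) (b w))
      ≡⟨ cong (λ u → z x + (z y + z w + S * dot (a y) (b w)) + S * u) (dot-+ʳ (a x) (b y) (b w)) ⟨
    z x + (z y + z w + S * dot (a y) (b w)) + S * dot (a x) (λ j → b y j + b w j) ∎)
    where open ≡.≡-Reasoning

  identityˡ : ∀ x → e ∙ x ≈ x
  identityˡ x = ≡⇒≈ (λ j → ℤP.+-identityˡ _) (λ j → ℤP.+-identityˡ _)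
    (≡.trans (cong (λ u → + 0 + z x + S * u) (dot-zerosˡ (b x)))
      (solve 2 (λ c s → con (+ 0) :+ c :+ s :* con (+ 0) := c) ≡.refl (z x) S))

  identityʳ : ∀ x → x ∙ e ≈ x
  identityʳ x = ≡⇒≈ (λ j → ℤP.+-identityʳ _) (λ j → ℤP.+-identityʳ _)
    (≡.trans (cong (λ u → z x + + 0 + S * u) (dot-zerosʳ (a x)))
      (solve 2 (λ c s → c :+ con (+ 0) :+ s :* con (+ 0) := c) ≡.refl (z x) S))

  inverseˡ : ∀ x → x ⁻¹ ∙ x ≈ e
  inverseˡ x = ≡⇒≈ (λ j → ℤP.+-inverseˡ (a x j)) (λ j → ℤP.+-inverseˡ (b x j))
    (≡.trans (cong (λ u → - z x + S * dot (a x) (b x) + z x + S * u) (dot-negˡ (a x) (b x)))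
      (solve 3 (λ c s d → (:- c) :+ s :* d :+ c :+ s :* (:- d) := con (+ 0)) ≡.refl (z x) S (dot (a x) (b x))))

  inverseʳ : ∀ x → x ∙ x ⁻¹ ≈ e
  inverseʳ x = ≡⇒≈ (λ j → ℤP.+-inverseʳ (a x j)) (λ j → ℤP.+-inverseʳ (b x j))
    (≡.trans (cong (λ u → z x + (- z x + S * dot (a x) (b x)) + S * u) (dot-negʳ (a x) (b x)))
      (solve 3 (λ c s d → c :+ ((:- c) :+ s :* d) :+ s :* (:- d) := con (+ 0)) ≡.refl (z x) S (dot (a x) (b x))))

  heisenberg : (c ℓ : Level) → Group c ℓ
  heisenberg c ℓ = record
    { Carrier = Lift c Element
    ; _≈_     = λ x y → Lift ℓ (lower x ≈ lower y)
    ; _∙_     = λ x y → lift (lower x ∙ lower y)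
    ; ε       = lift e
    ; _⁻¹     = λ x → lift (lower x ⁻¹)
    ; isGroup = record
      { isMonoid = record
        { isSemigroup = record
          { isMagma = record
            { isEquivalence = record
              { refl  = lift ≈-refl
              ; sym   = λ x≈y → lift (≈-sym (lower x≈y))
              ; trans = λ x≈y y≈z → lift (≈-trans (lower x≈y) (lower y≈z)) }
            ; ∙-cong = λ x≈y u≈v → lift (∙-cong (lower x≈y) (lower u≈v)) }
          ; assoc = λ x y z → lift (assoc (lower x) (lower y) (lower z)) }
        ; identity = (λ x → lift (identityˡ (lower x))) , (λ x → lift (identityʳ (lower x))) }
      ; inverse = (λ x → lift (inverseˡ (lower x))) , (λ x → lift (inverseʳ (lower x)))
      ; ⁻¹-cong = λ x≈y → lift (⁻¹-cong (lower x≈y)) }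
    }

  module AtLevel (c ℓ : Level) where
    private
      H = heisenberg c ℓ
      module H = Group H

    pow-isotropic : ∀ x k → dot (a x) (b x) ≡ + 0 →
      pow H (lift x) k H.≈ lift (mk (λ j → + k * a x j) (λ j → + k * b x j) (+ k * z x))
    pow-isotropic x zero    _ =
      lift (≡⇒≈ (λ j → ≡.sym (ℤP.*-zeroˡ (a x j))) (λ j → ≡.sym (ℤP.*-zeroˡ (b x j))) (≡.sym (ℤP.*-zeroˡ (z x))))
    pow-isotropic x (suc k) ⟨a,b⟩≡0 = H.trans (H.∙-congˡ {lift x} (pow-isotropic x k ⟨a,b⟩≡0)) (lift (≡⇒≈
      (λ j → ≡.sym (ℤP.suc-* (+ k) (a x j))) (λ j → ≡.sym (ℤP.suc-* (+ k) (b x j))) (begin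
        z x + + k * z x + S * dot (a x) (λ j → + k * b x j)  ≡⟨ cong (λ u → z x + + k * z x + S * u) (dot-scaleʳ (+ k) (a x) (b x)) ⟩
        z x + + k * z x + S * (+ k * dot (a x) (b x))        ≡⟨ cong (λ u → z x + + k * z x + S * (+ k * u)) ⟨a,b⟩≡0 ⟩
        z x + + k * z x + S * (+ k * + 0)
          ≡⟨ solve 3 (λ z k s → z :+ k :* z :+ s :* (k :* con (+ 0)) := z :+ k :* z) ≡.refl (z x) (+ k) S ⟩
        z x + + k * z x                                      ≡⟨ ℤP.suc-* (+ k) (z x) ⟨
        + suc k * z x                                        ∎)))
      where open ≡.≡-Reasoning

    commute-by-dot : ∀ x y → dot (a x) (b y) ≡ dot (a y) (b x) → GroupTheory.Commute H (lift x) (lift y)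
    commute-by-dot x y ⟨x,y⟩≡⟨y,x⟩ = lift (≡⇒≈ (λ j → ℤP.+-comm (a x j) (a y j)) (λ j → ℤP.+-comm (b x j) (b y j))
      (cong₂ (λ u v → u + S * v) (ℤP.+-comm (z x) (z y)) ⟨x,y⟩≡⟨y,x⟩))

    commutator : ∀ x y → comm H (lift x) (lift y) H.≈ lift (mk zeros zeros (S * (dot (a x) (b y) - dot (a y) (b x))))
    commutator x y = lift (≡⇒≈
      (λ j → solve 2 (λ u v → (:- u :+ :- v) :+ u :+ v := con (+ 0)) ≡.refl (a x j) (a y j))
      (λ j → solve 2 (λ u v → (:- u :+ :- v) :+ u :+ v := con (+ 0)) ≡.refl (b x j) (b y j))
      z-commutator)
      where
      dot-neg-neg : dot (λ j → - a x j) (λ j → - b y j) ≡ dot (a x) (b y)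
      dot-neg-neg = ≡.trans (dot-negˡ (a x) _) (≡.trans (cong -_ (dot-negʳ (a x) (b y))) (ℤP.neg-involutive _))
      dot-neg-+ : ∀ {v} → dot (λ j → - a x j + - a y j) v ≡ - dot (a x) v + - dot (a y) v
      dot-neg-+ {v} = ≡.trans (dot-+ˡ _ _ v) (cong₂ _+_ (dot-negˡ (a x) v) (dot-negˡ (a y) v))
      dot-neg-+-+ : dot (λ j → - a x j + - a y j + a x j) (b y) ≡ - dot (a x) (b y) + - dot (a y) (b y) + dot (a x) (b y)
      dot-neg-+-+ = ≡.trans (dot-+ˡ _ (a x) (b y)) (cong (_+ dot (a x) (b y)) dot-neg-+)
      z-commutator : z (x ⁻¹ ∙ y ⁻¹ ∙ x ∙ y) ≡ S * (dot (a x) (b y) - dot (a y) (b x))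
      z-commutator rewrite dot-neg-neg | dot-neg-+ {b x} | dot-neg-+-+ =
        solve 7 (λ s zx zy dxx dyy dxy dyx →
          (:- zx :+ s :* dxx) :+ (:- zy :+ s :* dyy) :+ s :* dxy :+ zx :+ s :* (:- dxx :+ :- dyx) :+ zy
            :+ s :* ((:- dxy :+ :- dyy) :+ dxy)
          := s :* (dxy :- dyx))
          ≡.refl S (z x) (z y) (dot (a x) (b x)) (dot (a y) (b y)) (dot (a x) (b y)) (dot (a y) (b x))

module HeisenbergModel {c ℓ : Level} (p d′ m : ℕ) (t : Fin m → Bool) where
  open +-*-Solver
  open IntegerCongruence
  open DotProduct
  open Heisenberg (+ p) (+ (p ^ suc d′)) m hiding (_≈_)
  open AtLevel c ℓ
  open import Data.Integer using (_*_; _-_)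

  M : Group c ℓ
  M = heisenberg c ℓ
  open Group M using (_≈_; trans; sym)

  indicator : Bool → ℤ
  indicator true  = + 1
  indicator false = + 0

  X Y : Fin m → Element
  X j = mk (δ j) zeros (indicator (t j))
  Y j = mk zeros (δ j) (+ 0)

  Z : Element
  Z = mk zeros zeros (+ p)

  generators : Gens m → Group.Carrier M
  generators (inj₁ j)         = lift (X j)
  generators (inj₂ (inj₁ j))  = lift (Y j)
  generators (inj₂ (inj₂ tt)) = lift Z

  pow-X : ∀ j k → pow M (lift (X j)) k ≈ lift (mk (λ i → + k * δ j i) (λ _ → + k * + 0) (+ k * indicator (t j)))
  pow-X j k = pow-isotropic (X j) k (dot-zerosʳ (δ j))

  pow-Y : ∀ j k → pow M (lift (Y j)) k ≈ lift (mk (λ _ → + k * + 0) (λ i → + k * δ j i) (+ k * + 0))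
  pow-Y j k = pow-isotropic (Y j) k (dot-zerosˡ (δ j))

  pow-Z : ∀ k → pow M (lift Z) k ≈ lift (mk (λ _ → + k * + 0) (λ _ → + k * + 0) (+ k * + p))
  pow-Z k = pow-isotropic Z k (dot-zerosˡ {m} zeros)

  generators-rels : TwistedRels M generators t p (suc d′)
  generators-rels = record
    { x-pow = x-pow
    ; y-pow = λ j → trans (pow-Y j p) (lift (vanishes p , *-≡0-mod ∘ δ j , ≡⇒≡[mod] (ℤP.*-zeroʳ (+ p))))
    ; z-pow = trans (pow-Z (p ^ suc d′)) (lift (vanishes (p ^ suc d′) , vanishes (p ^ suc d′) , z-pow))
    ; x-x = λ i j → commute-by-dot (X i) (X j) (≡.trans (dot-zerosʳ (δ i)) (≡.sym (dot-zerosʳ (δ j))))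
    ; y-y = λ i j → commute-by-dot (Y i) (Y j) (≡.trans (dot-zerosˡ (δ j)) (≡.sym (dot-zerosˡ (δ i))))
    ; x-y = λ i j i≢j → commute-by-dot (X i) (Y j) (≡.trans (dot-δ-δ-≢ i j i≢j) (≡.sym (dot-zerosˡ {m} zeros)))
    ; x-z = λ i → commute-by-dot (X i) Z (≡.trans (dot-zerosʳ (δ i)) (≡.sym (dot-zerosˡ {m} zeros)))
    ; y-z = λ i → commute-by-dot (Y i) Z (≡.trans (dot-zerosˡ {m} zeros) (≡.sym (dot-zerosˡ (δ i))))
    ; [x,y]≈z = λ i → trans (commutator (X i) (Y i))
        (trans (lift (≡⇒≈ (λ _ → ≡.sym (ℤP.*-zeroʳ (+ (p ^ d′)))) (λ _ → ≡.sym (ℤP.*-zeroʳ (+ (p ^ d′)))) (z-commutator i)))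
               (sym (pow-Z (p ^ d′))))
    }
    where
    vanishes : ∀ k {M} (j : Fin m) → + k * + 0 ≡ + 0 [mod M ]
    vanishes k _ = ≡⇒≡[mod] (ℤP.*-zeroʳ (+ k))
    x-pow : ∀ i → pow M (lift (X i)) p ≈ (if t i then lift Z else lift e)
    x-pow i with t i | pow-X i p
    ... | true  | xᵖ≈ = trans xᵖ≈ (lift (*-≡0-mod ∘ δ i , vanishes p , ≡⇒≡[mod] (ℤP.*-identityʳ (+ p))))
    ... | false | xᵖ≈ = trans xᵖ≈ (lift (*-≡0-mod ∘ δ i , vanishes p , ≡⇒≡[mod] (ℤP.*-zeroʳ (+ p))))
    z-pow : + (p ^ suc d′) * + p ≡ + 0 [mod + p * + (p ^ suc d′) ]
    z-pow = + 1 , solve 2 (λ S P → S :* P := con (+ 0) :+ con (+ 1) :* (P :* S)) ≡.refl (+ (p ^ suc d′)) (+ p)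
    z-commutator : ∀ i → + (p ^ suc d′) * (dot (δ i) (δ i) - dot {m} zeros zeros) ≡ + (p ^ d′) * + p
    z-commutator i = begin
      + (p ^ suc d′) * (dot (δ i) (δ i) - dot {m} zeros zeros)
        ≡⟨ cong₂ (λ u v → + (p ^ suc d′) * (u - v)) (dot-δ-δ i) (dot-zerosˡ {m} zeros) ⟩
      + (p ^ suc d′) * + 1  ≡⟨ ℤP.*-identityʳ _ ⟩
      + (p ℕ.* p ^ d′)      ≡⟨ cong +_ (ℕP.*-comm p (p ^ d′)) ⟩
      + (p ^ d′ ℕ.* p)      ≡⟨ ℤP.pos-* (p ^ d′) p ⟩
      + (p ^ d′) * + p      ∎
      where open ≡.≡-Reasoning

module CentralPower {c ℓ} {p d′ m : ℕ} {t : Fin m → Bool} {G : Group c ℓ} {g : Gens m → Group.Carrier G}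
                    (pr : IsPresentedBy (Gens m) (λ H h → TwistedRels H h t p (suc d′)) G g) where
  open Group G
  open GroupTheory G using (pow-central; pow-*)
  open TwistedRels (Presentation.relations pr)

  zg-central : InCenter G (zg G g)
  zg-central = Presentation.commute-image pr G (Id.isGroupHomomorphism (Group.rawGroup G) refl) (zg G g) commutes
    where
    commutes : ∀ i → zg G g ∙ g i ≈ g i ∙ zg G g
    commutes (inj₁ i)         = sym (x-z i)
    commutes (inj₂ (inj₁ i))  = sym (y-z i)
    commutes (inj₂ (inj₂ tt)) = refl

  central-power : Carrier
  central-power = pow G (zg G g) (p ^ d′)

  central-power-central : InCenter G central-power
  central-power-central = pow-central (p ^ d′) zg-central

  central-power^p≈ε : pow G central-power p ≈ ε
  central-power^p≈ε = trans (sym (pow-* (zg G g) p (p ^ d′))) z-pow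

  -- In the Heisenberg model w^k becomes the central element with z-coordinate k · p^(d′+1),
  -- which vanishes modulo p^(d′+2) only when p ∣ k.
  central-power-order : .{{ℕ.NonZero p}} → ∀ k → pow G central-power k ≈ ε → p ∣ k
  central-power-order k wᵏ≈ε =
    *-cancel-mod (p ^ suc d′) {{ℕP.m^n≢0 p (suc d′)}}
      (≡[mod]-trans (≡⇒≡[mod] rearrange) (proj₂ (proj₂ (lower (M.trans (M.sym (pow-Z (k ℕ.* s))) Zᵏˢ≈ε)))))
    where
    open IntegerCongruence
    open HeisenbergModel {c} {ℓ} p d′ m t
    open Presentation pr using (induced-hom)
    module M = Group M
    module MT = GroupTheory M
    open SetoidReasoning M.setoid
    s = p ^ d′
    h = proj₁ (induced-hom M generators generators-rels)
    h-hom = proj₁ (proj₂ (induced-hom M generators generators-rels))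
    h-gen = proj₂ (proj₂ (induced-hom M generators generators-rels))
    open GroupMorphisms.IsGroupHomomorphism h-hom

    Zᵏˢ≈ε : pow M (lift Z) (k ℕ.* s) M.≈ M.ε
    Zᵏˢ≈ε = begin
      pow M (lift Z) (k ℕ.* s)          ≈⟨ MT.pow-* (lift Z) k s ⟩
      pow M (pow M (lift Z) s) k        ≈⟨ MT.pow-cong k (MT.pow-cong s (h-gen (inj₂ (inj₂ tt)))) ⟨
      pow M (pow M (h (zg G g)) s) k    ≈⟨ MT.pow-cong k (pow-homo h-hom (zg G g) s) ⟨
      pow M (h (pow G (zg G g) s)) k    ≈⟨ pow-homo h-hom _ k ⟨
      h (pow G (pow G (zg G g) s) k)    ≈⟨ ⟦⟧-cong wᵏ≈ε ⟩
      h ε                               ≈⟨ ε-homo ⟩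
      M.ε                               ∎

    rearrange : + k ℤ.* + (p ^ suc d′) ≡ + (k ℕ.* s) ℤ.* + p
    rearrange = ≡.trans (≡.sym (ℤP.pos-* k (p ℕ.* s)))
                (≡.trans (cong +_ (≡.trans (cong (k ℕ.*_) (ℕP.*-comm p s)) (≡.sym (ℕP.*-assoc k s p))))
                         (ℤP.pos-* (k ℕ.* s) p))

-- The splitting

data Slot {m} (k₀ : Fin (suc m)) : Fin (suc m) → Set where
  here  : Slot k₀ k₀
  there : (j : Fin m) → Slot k₀ (punchIn k₀ j)

slot : ∀ {m} (k₀ i : Fin (suc m)) → Slot k₀ i
slot k₀ i with k₀ FinP.≟ i
... | yes ≡.refl = here
... | no  k₀≢i  = ≡.subst (Slot k₀) (FinP.punchIn-punchOut k₀≢i) (there (punchOut k₀≢i))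

slot-elim : ∀ {m a} (k₀ : Fin (suc m)) (C : Fin (suc m) → Set a) → C k₀ → (∀ j → C (punchIn k₀ j)) → ∀ i → C i
slot-elim k₀ C c-here c-there i with slot k₀ i
... | here    = c-here
... | there j = c-there j

module Splitting {c ℓ : Level} (p′ d′ m : ℕ)
  {t′ : Fin m → Bool} {t : Fin (suc m) → Bool} (k₀ : Fin (suc m))
  (t-k₀ : t k₀ ≡ false) (t-punchIn : ∀ j → t (punchIn k₀ j) ≡ t′ j)
  {G G′ K : Group c ℓ}
  {g : Gens (suc m) → Group.Carrier G} (G-pres : IsPresentedBy (Gens (suc m)) (λ H h → TwistedRels H h t (suc p′) (suc d′)) G g)
  {g′ : Gens m → Group.Carrier G′} (G′-pres : IsPresentedBy (Gens m) (λ H h → TwistedRels H h t′ (suc p′) (suc d′)) G′ g′)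
  {κ : Gens 1 → Group.Carrier K} (K-pres : IsPresentedBy (Gens 1) (λ H h → TwistedRels H h untwisted (suc p′) 1) K κ)
  where

  p s : ℕ
  p = suc p′
  s = p ^ d′

  private
    module G = Group G
    module G′ = Group G′
    module K = Group K
    module GT = GroupTheory G
    module G′T = GroupTheory G′
    module KT = GroupTheory K
    module Gr = TwistedRels (Presentation.relations G-pres)
    module G′r = TwistedRels (Presentation.relations G′-pres)
    module Kr = TwistedRels (Presentation.relations K-pres)
    module Gc = CentralPower G-pres
    module G′c = CentralPower G′-pres
    module Kc = CentralPower K-pres

  x y : Fin (suc m) → G.Carrier
  x = xg G g
  y = yg G g
  z w : G.Carrier
  z = zg G g
  w = Gc.central-power

  x′ y′ : Fin m → G′.Carrier
  x′ = xg G′ g′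
  y′ = yg G′ g′
  z′ w′ : G′.Carrier
  z′ = zg G′ g′
  w′ = G′c.central-power

  xK yK zK wK : K.Carrier
  xK = xg K κ zero
  yK = yg K κ zero
  zK = zg K κ
  wK = Kc.central-power

  P : Group c ℓ
  P = G′ ⊗ K
  private
    module P = Group P
    module PT = GroupTheory P

  b : P.Carrier
  b = w′ , wK K.⁻¹

  pow-b : ∀ k → pow P b k P.≈ (pow G′ w′ k , pow K wK k K.⁻¹)
  pow-b k = pow-homo (proj₁-isHom {G = G′} {H = K}) b k , K.trans (pow-homo (proj₂-isHom {G = G′} {H = K}) b k) (KT.pow-⁻¹ wK k)

  b^p≈ε : pow P b p P.≈ P.ε
  b^p≈ε = P.trans (pow-b p) (G′c.central-power^p≈ε , K.trans (K.⁻¹-cong Kc.central-power^p≈ε) (GroupProperties.ε⁻¹≈ε K))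

  wK⁻ᵏ-order : ∀ k → pow K wK k K.⁻¹ K.≈ K.ε → p ∣ k
  wK⁻ᵏ-order k wK⁻ᵏ≈ε = Kc.central-power-order k
    (GroupProperties.⁻¹-injective K (K.trans wK⁻ᵏ≈ε (K.sym (GroupProperties.ε⁻¹≈ε K))))

  b-order : ∀ k → pow P b k P.≈ P.ε → p ∣ k
  b-order k bᵏ≈ε = wK⁻ᵏ-order k (K.trans (K.sym (proj₂ (pow-b k))) (proj₂ bᵏ≈ε))

  B : Pred P.Carrier ℓ
  B = PT.⟨ b ⟩

  B-sub : IsSubgroup P B
  B-sub = PT.FiniteOrder.⟨g⟩-isSubgroup {p′} b b^p≈ε

  B-central : ∀ q → B q → InCenter G′ (proj₁ q) × InCenter K (proj₂ q)
  B-central q Bq = central-components {G = G′} {H = K} (PT.⟨⟩-central b-central q Bq)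
    where
    b-central : InCenter P b
    b-central = ⊗-central {G = G′} {H = K} G′c.central-power-central (KT.⁻¹-central Kc.central-power-central)

  B-size : HasSize P B p
  B-size = PT.FiniteOrder.ExactOrder.⟨g⟩-hasSize {p′} b b^p≈ε b-order

  B-normal : IsNormal P B
  B-normal = central⇒normal P B B-sub (λ a Ba g → B-central a Ba .proj₁ (proj₁ g) , B-central a Ba .proj₂ (proj₂ g))

  Q : Group c ℓ
  Q = quotient P B B-sub B-normal
  private
    module Q = Group Q
    module QT = GroupTheory Q
  open Quotient P B-sub B-normal

  ι₁ : G′.Carrier → Q.Carrier
  ι₁ a = a , K.ε

  ι₂ : K.Carrier → Q.Carrier
  ι₂ v = G′.ε , v

  ι₁-isHom : IsHom G′ Q ι₁
  ι₁-isHom = Comp.isGroupHomomorphism Q.trans (inj₁-isHom {G = G′} {H = K}) quotient-map-isHom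

  ι₂-isHom : IsHom K Q ι₂
  ι₂-isHom = Comp.isGroupHomomorphism Q.trans (inj₂-isHom {G = G′} {H = K}) quotient-map-isHom

  ι₂wK∼ι₁w′ : ι₂ wK Q.≈ ι₁ w′
  ι₂wK∼ι₁w′ = 1 , G′.trans (G′.∙-congʳ (GroupProperties.ε⁻¹≈ε G′)) (G′.trans (G′.identityˡ w′) (G′.sym (G′.identityʳ w′)))
                , K.refl

  ι₁-injective : ∀ {a a′} → ι₁ a Q.≈ ι₁ a′ → a G′.≈ a′
  ι₁-injective (k , a⁻¹a′≈ , ε≈) = G′T.x⁻¹∙y≈ε⇒x≈y (G′.trans (G′.trans a⁻¹a′≈ (proj₁ (pow-b k)))
    (G′T.FiniteOrder.pow-∣ {p′} w′ G′c.central-power^p≈ε (wK⁻ᵏ-order k (K.trans (K.sym (K.trans ε≈ (proj₂ (pow-b k)))) (K.inverseˡ K.ε)))))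

  ι₂-injective : ∀ {v v′} → ι₂ v Q.≈ ι₂ v′ → v K.≈ v′
  ι₂-injective (k , ε≈ , v⁻¹v′≈) = KT.x⁻¹∙y≈ε⇒x≈y (K.trans (K.trans v⁻¹v′≈ (proj₂ (pow-b k)))
    (K.trans (K.⁻¹-cong (KT.FiniteOrder.pow-∣ {p′} wK Kc.central-power^p≈ε p∣k)) (GroupProperties.ε⁻¹≈ε K)))
    where
    p∣k : p ∣ k
    p∣k = G′c.central-power-order k (G′.trans (G′.sym (G′.trans ε≈ (proj₁ (pow-b k)))) (G′.inverseˡ G′.ε))

  α-images : Gens m → G.Carrier
  α-images (inj₁ j)         = x (punchIn k₀ j)
  α-images (inj₂ (inj₁ j))  = y (punchIn k₀ j)
  α-images (inj₂ (inj₂ tt)) = z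

  α-rels : TwistedRels G α-images t′ p (suc d′)
  α-rels = record
    { x-pow   = λ j → ≡.subst (λ u → pow G (x (punchIn k₀ j)) p G.≈ (if u then z else G.ε)) (t-punchIn j) (Gr.x-pow (punchIn k₀ j))
    ; y-pow   = Gr.y-pow ∘ punchIn k₀
    ; z-pow   = Gr.z-pow
    ; x-x     = λ i j → Gr.x-x (punchIn k₀ i) (punchIn k₀ j)
    ; y-y     = λ i j → Gr.y-y (punchIn k₀ i) (punchIn k₀ j)
    ; x-y     = λ i j i≢j → Gr.x-y (punchIn k₀ i) (punchIn k₀ j) (i≢j ∘ FinP.punchIn-injective k₀ i j)
    ; x-z     = Gr.x-z ∘ punchIn k₀
    ; y-z     = Gr.y-z ∘ punchIn k₀
    ; [x,y]≈z = Gr.[x,y]≈z ∘ punchIn k₀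
    }

  α : G′.Carrier → G.Carrier
  α = proj₁ (Presentation.induced-hom G′-pres G α-images α-rels)

  α-hom : IsHom G′ G α
  α-hom = proj₁ (proj₂ (Presentation.induced-hom G′-pres G α-images α-rels))

  α-gen : ∀ j → α (g′ j) G.≈ α-images j
  α-gen = proj₂ (proj₂ (Presentation.induced-hom G′-pres G α-images α-rels))

  β-images : Gens 1 → G.Carrier
  β-images (inj₁ _)         = x k₀
  β-images (inj₂ (inj₁ _))  = y k₀
  β-images (inj₂ (inj₂ tt)) = w

  β-rels : TwistedRels G β-images untwisted p 1
  β-rels = record
    { x-pow   = λ _ → ≡.subst (λ u → pow G (x k₀) p G.≈ (if u then z else G.ε)) t-k₀ (Gr.x-pow k₀)
    ; y-pow   = λ _ → Gr.y-pow k₀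
    ; z-pow   = G.trans (GT.pow-≡ w (ℕP.*-identityʳ p)) Gc.central-power^p≈ε
    ; x-x     = λ { zero zero → G.refl }
    ; y-y     = λ { zero zero → G.refl }
    ; x-y     = λ { zero zero 0≢0 → ⊥-elim (0≢0 ≡.refl) }
    ; x-z     = λ _ → G.sym (Gc.central-power-central (x k₀))
    ; y-z     = λ _ → G.sym (Gc.central-power-central (y k₀))
    ; [x,y]≈z = λ _ → G.trans (Gr.[x,y]≈z k₀) (G.sym (G.identityʳ w))
    }

  β : K.Carrier → G.Carrier
  β = proj₁ (Presentation.induced-hom K-pres G β-images β-rels)

  β-hom : IsHom K G β
  β-hom = proj₁ (proj₂ (Presentation.induced-hom K-pres G β-images β-rels))

  β-gen : ∀ i → β (κ i) G.≈ β-images i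
  β-gen = proj₂ (proj₂ (Presentation.induced-hom K-pres G β-images β-rels))

  images-commute : ∀ i j → GT.Commute (β-images i) (α-images j)
  images-commute (inj₁ _)         (inj₁ j)         = Gr.x-x k₀ (punchIn k₀ j)
  images-commute (inj₁ _)         (inj₂ (inj₁ j))  = Gr.x-y k₀ (punchIn k₀ j) (FinP.punchInᵢ≢i k₀ j ∘ ≡.sym)
  images-commute (inj₁ _)         (inj₂ (inj₂ tt)) = Gr.x-z k₀
  images-commute (inj₂ (inj₁ _))  (inj₁ j)         = G.sym (Gr.x-y (punchIn k₀ j) k₀ (FinP.punchInᵢ≢i k₀ j))
  images-commute (inj₂ (inj₁ _))  (inj₂ (inj₁ j))  = Gr.y-y k₀ (punchIn k₀ j)
  images-commute (inj₂ (inj₁ _))  (inj₂ (inj₂ tt)) = Gr.y-z k₀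
  images-commute (inj₂ (inj₂ tt)) j                = Gc.central-power-central (α-images j)

  α-β-commute : ∀ a v → GT.Commute (α a) (β v)
  α-β-commute a = Presentation.commute-image K-pres G β-hom (α a) λ i → G.sym (β-α-commute i a)
    where
    β-α-commute : ∀ i a → GT.Commute (β (κ i)) (α a)
    β-α-commute i = Presentation.commute-image G′-pres G α-hom (β (κ i))
      λ j → GT.commute-resp (β-gen i) (α-gen j) (images-commute i j)

  α-w′ : α w′ G.≈ w
  α-w′ = G.trans (pow-homo {G = G′} {H = G} α-hom z′ s) (GT.pow-cong s (α-gen (inj₂ (inj₂ tt))))

  β-wK : β wK G.≈ w
  β-wK = G.trans (pow-homo {G = K} {H = G} β-hom zK 1) (G.trans (GT.pow-cong 1 (β-gen (inj₂ (inj₂ tt)))) (G.identityʳ w))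

  ψ : Q.Carrier → G.Carrier
  ψ q = α (proj₁ q) G.∙ β (proj₂ q)

  ψ-product-hom : IsHom P G ψ
  ψ-product-hom = commuting-product-isHom {G = G′} {H = K} {K = G} α-hom β-hom α-β-commute

  ψ-b : ψ b G.≈ G.ε
  ψ-b = G.trans (G.∙-cong α-w′ (G.trans (⁻¹-homo wK) (G.⁻¹-cong β-wK))) (G.inverseʳ w)
    where open GroupMorphisms.IsGroupHomomorphism β-hom

  ψ-hom : IsHom Q G ψ
  ψ-hom = quotient-lift-isHom {H = G} ψ-product-hom λ q (k , q≈bᵏ) →
    G.trans (⟦⟧-cong q≈bᵏ) (G.trans (pow-homo {G = P} {H = G} ψ-product-hom b k) (G.trans (GT.pow-cong k ψ-b) (GT.ε-pow k)))
    where open GroupMorphisms.IsGroupHomomorphism ψ-product-hom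

  ψ-ι₁ : ∀ a → ψ (ι₁ a) G.≈ α a
  ψ-ι₁ a = G.trans (G.∙-congˡ (GroupMorphisms.IsGroupHomomorphism.ε-homo β-hom)) (G.identityʳ (α a))

  ψ-ι₂ : ∀ v → ψ (ι₂ v) G.≈ β v
  ψ-ι₂ v = G.trans (G.∙-congʳ (GroupMorphisms.IsGroupHomomorphism.ε-homo α-hom)) (G.identityˡ (β v))

  x̂ ŷ : Fin (suc m) → Q.Carrier
  x̂ = insertAt (ι₁ ∘ x′) k₀ (ι₂ xK)
  ŷ = insertAt (ι₁ ∘ y′) k₀ (ι₂ yK)

  x̂-here : x̂ k₀ ≡ ι₂ xK
  x̂-here = insertAt-lookup (ι₁ ∘ x′) k₀ (ι₂ xK)

  ŷ-here : ŷ k₀ ≡ ι₂ yK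
  ŷ-here = insertAt-lookup (ι₁ ∘ y′) k₀ (ι₂ yK)

  x̂-there : ∀ j → x̂ (punchIn k₀ j) ≡ ι₁ (x′ j)
  x̂-there = insertAt-punchIn (ι₁ ∘ x′) k₀ (ι₂ xK)

  ŷ-there : ∀ j → ŷ (punchIn k₀ j) ≡ ι₁ (y′ j)
  ŷ-there = insertAt-punchIn (ι₁ ∘ y′) k₀ (ι₂ yK)

  φ-images : Gens (suc m) → Q.Carrier
  φ-images (inj₁ i)         = x̂ i
  φ-images (inj₂ (inj₁ i))  = ŷ i
  φ-images (inj₂ (inj₂ tt)) = ι₁ z′

  ι₁-ι₂-commute : ∀ a v → GroupTheory.Commute Q (ι₁ a) (ι₂ v)
  ι₁-ι₂-commute a v =
    ≈⇒∼ (G′.trans (G′.identityʳ a) (G′.sym (G′.identityˡ a)) , K.trans (K.identityˡ v) (K.sym (K.identityʳ v)))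

  ι₁-commute : ∀ {a a′} → G′T.Commute a a′ → GroupTheory.Commute Q (ι₁ a) (ι₁ a′)
  ι₁-commute = commute-homo {G = G′} {H = Q} ι₁-isHom

  ι₁-pow : ∀ a k → pow Q (ι₁ a) k Q.≈ ι₁ (pow G′ a k)
  ι₁-pow a k = Q.sym (pow-homo {G = G′} {H = Q} ι₁-isHom a k)

  ι₁-comm : ∀ a a′ → comm Q (ι₁ a) (ι₁ a′) Q.≈ ι₁ (comm G′ a a′)
  ι₁-comm a a′ = Q.sym (comm-homo {G = G′} {H = Q} ι₁-isHom a a′)

  ι₁-cong : ∀ {a a′} → a G′.≈ a′ → ι₁ a Q.≈ ι₁ a′
  ι₁-cong = GroupMorphisms.IsGroupHomomorphism.⟦⟧-cong ι₁-isHom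

  ι₂-cong : ∀ {v v′} → v K.≈ v′ → ι₂ v Q.≈ ι₂ v′
  ι₂-cong = GroupMorphisms.IsGroupHomomorphism.⟦⟧-cong ι₂-isHom

  ι₁z′ˢ≈ι₁w′ : pow Q (ι₁ z′) s Q.≈ ι₁ w′
  ι₁z′ˢ≈ι₁w′ = ι₁-pow z′ s

  x̂ₖ₀-pow : pow Q (x̂ k₀) p Q.≈ (if t k₀ then ι₁ z′ else Q.ε)
  x̂ₖ₀-pow = Q.trans (QT.pow-cong p (Q.reflexive x̂-here))
    (Q.trans (Q.sym (pow-homo {G = K} {H = Q} ι₂-isHom xK p))
      (Q.trans (ι₂-cong (Kr.x-pow zero)) (Q.reflexive (cong (λ u → if u then ι₁ z′ else Q.ε) (≡.sym t-k₀)))))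

  x̂-there-pow : ∀ j → pow Q (x̂ (punchIn k₀ j)) p Q.≈ (if t (punchIn k₀ j) then ι₁ z′ else Q.ε)
  x̂-there-pow j = Q.trans (QT.pow-cong p (Q.reflexive (x̂-there j)))
    (Q.trans (ι₁-pow (x′ j) p) (Q.trans (ι₁-cong (G′r.x-pow j))
      (Q.reflexive (≡.trans (if-float ι₁ (t′ j)) (cong (λ u → if u then ι₁ z′ else Q.ε) (≡.sym (t-punchIn j)))))))

  ŷₖ₀-pow : pow Q (ŷ k₀) p Q.≈ Q.ε
  ŷₖ₀-pow = Q.trans (QT.pow-cong p (Q.reflexive ŷ-here))
    (Q.trans (Q.sym (pow-homo {G = K} {H = Q} ι₂-isHom yK p)) (ι₂-cong (Kr.y-pow zero)))

  ŷ-there-pow : ∀ j → pow Q (ŷ (punchIn k₀ j)) p Q.≈ Q.ε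
  ŷ-there-pow j = Q.trans (QT.pow-cong p (Q.reflexive (ŷ-there j)))
    (Q.trans (ι₁-pow (y′ j) p) (ι₁-cong (G′r.y-pow j)))

  [x̂,ŷ]ₖ₀ : comm Q (x̂ k₀) (ŷ k₀) Q.≈ pow Q (ι₁ z′) s
  [x̂,ŷ]ₖ₀ = Q.trans (QT.comm-cong (Q.reflexive x̂-here) (Q.reflexive ŷ-here))
    (Q.trans (Q.sym (comm-homo {G = K} {H = Q} ι₂-isHom xK yK))
      (Q.trans (ι₂-cong (Kr.[x,y]≈z zero)) (Q.trans ι₂wK∼ι₁w′ (Q.sym ι₁z′ˢ≈ι₁w′))))

  [x̂,ŷ]-there : ∀ j → comm Q (x̂ (punchIn k₀ j)) (ŷ (punchIn k₀ j)) Q.≈ pow Q (ι₁ z′) s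
  [x̂,ŷ]-there j = Q.trans (QT.comm-cong (Q.reflexive (x̂-there j)) (Q.reflexive (ŷ-there j)))
    (Q.trans (ι₁-comm (x′ j) (y′ j)) (Q.trans (ι₁-cong (G′r.[x,y]≈z j)) (Q.sym ι₁z′ˢ≈ι₁w′)))

  x̂-x̂-commute : ∀ i i′ → GroupTheory.Commute Q (x̂ i) (x̂ i′)
  x̂-x̂-commute i i′ with slot k₀ i | slot k₀ i′
  ... | here    | here     = Q.refl
  ... | here    | there j′ rewrite x̂-here | x̂-there j′ = Q.sym (ι₁-ι₂-commute (x′ j′) xK)
  ... | there j | here     rewrite x̂-here | x̂-there j  = ι₁-ι₂-commute (x′ j) xK
  ... | there j | there j′ rewrite x̂-there j | x̂-there j′ = ι₁-commute (G′r.x-x j j′)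

  ŷ-ŷ-commute : ∀ i i′ → GroupTheory.Commute Q (ŷ i) (ŷ i′)
  ŷ-ŷ-commute i i′ with slot k₀ i | slot k₀ i′
  ... | here    | here     = Q.refl
  ... | here    | there j′ rewrite ŷ-here | ŷ-there j′ = Q.sym (ι₁-ι₂-commute (y′ j′) yK)
  ... | there j | here     rewrite ŷ-here | ŷ-there j  = ι₁-ι₂-commute (y′ j) yK
  ... | there j | there j′ rewrite ŷ-there j | ŷ-there j′ = ι₁-commute (G′r.y-y j j′)

  x̂-ŷ-commute : ∀ i i′ → ¬ i ≡ i′ → GroupTheory.Commute Q (x̂ i) (ŷ i′)
  x̂-ŷ-commute i i′ i≢i′ with slot k₀ i | slot k₀ i′
  ... | here    | here     = ⊥-elim (i≢i′ ≡.refl)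
  ... | here    | there j′ rewrite x̂-here | ŷ-there j′ = Q.sym (ι₁-ι₂-commute (y′ j′) xK)
  ... | there j | here     rewrite x̂-there j | ŷ-here  = ι₁-ι₂-commute (x′ j) yK
  ... | there j | there j′ rewrite x̂-there j | ŷ-there j′ = ι₁-commute (G′r.x-y j j′ (i≢i′ ∘ cong (punchIn k₀)))

  x̂-ẑ-commute : ∀ i → GroupTheory.Commute Q (x̂ i) (ι₁ z′)
  x̂-ẑ-commute i with slot k₀ i
  ... | here    rewrite x̂-here    = Q.sym (ι₁-ι₂-commute z′ xK)
  ... | there j rewrite x̂-there j = ι₁-commute (G′r.x-z j)

  ŷ-ẑ-commute : ∀ i → GroupTheory.Commute Q (ŷ i) (ι₁ z′)
  ŷ-ẑ-commute i with slot k₀ i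
  ... | here    rewrite ŷ-here    = Q.sym (ι₁-ι₂-commute z′ yK)
  ... | there j rewrite ŷ-there j = ι₁-commute (G′r.y-z j)

  φ-rels : TwistedRels Q φ-images t p (suc d′)
  φ-rels = record
    { x-pow   = slot-elim k₀ (λ i → pow Q (x̂ i) p Q.≈ (if t i then ι₁ z′ else Q.ε)) x̂ₖ₀-pow x̂-there-pow
    ; y-pow   = slot-elim k₀ (λ i → pow Q (ŷ i) p Q.≈ Q.ε) ŷₖ₀-pow ŷ-there-pow
    ; z-pow   = Q.trans (ι₁-pow z′ (p ^ suc d′)) (ι₁-cong G′r.z-pow)
    ; x-x     = x̂-x̂-commute
    ; y-y     = ŷ-ŷ-commute
    ; x-y     = x̂-ŷ-commute
    ; x-z     = x̂-ẑ-commute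
    ; y-z     = ŷ-ẑ-commute
    ; [x,y]≈z = slot-elim k₀ (λ i → comm Q (x̂ i) (ŷ i) Q.≈ pow Q (ι₁ z′) s) [x̂,ŷ]ₖ₀ [x̂,ŷ]-there
    }

  φ : G.Carrier → Q.Carrier
  φ = proj₁ (Presentation.induced-hom G-pres Q φ-images φ-rels)

  φ-hom : IsHom G Q φ
  φ-hom = proj₁ (proj₂ (Presentation.induced-hom G-pres Q φ-images φ-rels))

  φ-gen : ∀ i → φ (g i) Q.≈ φ-images i
  φ-gen = proj₂ (proj₂ (Presentation.induced-hom G-pres Q φ-images φ-rels))

  private
    module φ = GroupMorphisms.IsGroupHomomorphism φ-hom
    module ψ = GroupMorphisms.IsGroupHomomorphism ψ-hom

  ψ-images : ∀ i → ψ (φ-images i) G.≈ g i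
  ψ-images (inj₁ i) = slot-elim k₀ (λ i → ψ (x̂ i) G.≈ x i)
    (G.trans (ψ.⟦⟧-cong (Q.reflexive x̂-here)) (G.trans (ψ-ι₂ xK) (β-gen (inj₁ zero))))
    (λ j → G.trans (ψ.⟦⟧-cong (Q.reflexive (x̂-there j))) (G.trans (ψ-ι₁ (x′ j)) (α-gen (inj₁ j)))) i
  ψ-images (inj₂ (inj₁ i)) = slot-elim k₀ (λ i → ψ (ŷ i) G.≈ y i)
    (G.trans (ψ.⟦⟧-cong (Q.reflexive ŷ-here)) (G.trans (ψ-ι₂ yK) (β-gen (inj₂ (inj₁ zero)))))
    (λ j → G.trans (ψ.⟦⟧-cong (Q.reflexive (ŷ-there j))) (G.trans (ψ-ι₁ (y′ j)) (α-gen (inj₂ (inj₁ j))))) i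
  ψ-images (inj₂ (inj₂ tt)) = G.trans (ψ-ι₁ z′) (α-gen (inj₂ (inj₂ tt)))

  ψφ≈id : ∀ a → ψ (φ a) G.≈ a
  ψφ≈id = Presentation.hom-ext G-pres G (Comp.isGroupHomomorphism G.trans φ-hom ψ-hom)
    (Id.isGroupHomomorphism (Group.rawGroup G) G.refl) (λ i → G.trans (ψ.⟦⟧-cong (φ-gen i)) (ψ-images i))

  φα≈ι₁ : ∀ a → φ (α a) Q.≈ ι₁ a
  φα≈ι₁ = Presentation.hom-ext G′-pres Q (Comp.isGroupHomomorphism Q.trans α-hom φ-hom) ι₁-isHom images
    where
    images : ∀ j → φ (α (g′ j)) Q.≈ ι₁ (g′ j)
    images (inj₁ j)         = Q.trans (φ.⟦⟧-cong (α-gen (inj₁ j)))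
                                (Q.trans (φ-gen (inj₁ (punchIn k₀ j))) (Q.reflexive (x̂-there j)))
    images (inj₂ (inj₁ j))  = Q.trans (φ.⟦⟧-cong (α-gen (inj₂ (inj₁ j))))
                                (Q.trans (φ-gen (inj₂ (inj₁ (punchIn k₀ j)))) (Q.reflexive (ŷ-there j)))
    images (inj₂ (inj₂ tt)) = Q.trans (φ.⟦⟧-cong (α-gen (inj₂ (inj₂ tt)))) (φ-gen (inj₂ (inj₂ tt)))

  φ-w : φ w Q.≈ ι₁ w′
  φ-w = Q.trans (pow-homo {G = G} {H = Q} φ-hom z s) (Q.trans (QT.pow-cong s (φ-gen (inj₂ (inj₂ tt)))) ι₁z′ˢ≈ι₁w′)

  φβ≈ι₂ : ∀ v → φ (β v) Q.≈ ι₂ v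
  φβ≈ι₂ = Presentation.hom-ext K-pres Q (Comp.isGroupHomomorphism Q.trans β-hom φ-hom) ι₂-isHom images
    where
    images : ∀ i → φ (β (κ i)) Q.≈ ι₂ (κ i)
    images (inj₁ zero)         = Q.trans (φ.⟦⟧-cong (β-gen (inj₁ zero)))
                                   (Q.trans (φ-gen (inj₁ k₀)) (Q.reflexive x̂-here))
    images (inj₂ (inj₁ zero))  = Q.trans (φ.⟦⟧-cong (β-gen (inj₂ (inj₁ zero))))
                                   (Q.trans (φ-gen (inj₂ (inj₁ k₀))) (Q.reflexive ŷ-here))
    images (inj₂ (inj₂ tt))    = Q.trans (φ.⟦⟧-cong (β-gen (inj₂ (inj₂ tt))))
      (Q.trans φ-w (Q.trans (Q.sym ι₂wK∼ι₁w′) (ι₂-cong (K.identityʳ zK))))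

  φψ≈id : ∀ q → φ (ψ q) Q.≈ q
  φψ≈id (a , v) = Q.trans (φ.homo (α a) (β v))
    (Q.trans (Q.∙-cong (φα≈ι₁ a) (φβ≈ι₂ v)) (≈⇒∼ (G′.identityʳ a , K.identityˡ v)))

  G≅Q : G ≅ Q
  G≅Q = inverse-homs⇒≅ {G = G} {H = Q} φ ψ φ-hom ψ.⟦⟧-cong ψφ≈id φψ≈id

  α-injective : ∀ {a a′} → α a G.≈ α a′ → a G′.≈ a′
  α-injective {a} {a′} αa≈αa′ =
    ι₁-injective (Q.trans (Q.sym (φα≈ι₁ a)) (Q.trans (φ.⟦⟧-cong αa≈αa′) (φα≈ι₁ a′)))

  β-injective : ∀ {v v′} → β v G.≈ β v′ → v K.≈ v′
  β-injective {v} {v′} βv≈βv′ =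
    ι₂-injective (Q.trans (Q.sym (φβ≈ι₂ v)) (Q.trans (φ.⟦⟧-cong βv≈βv′) (φβ≈ι₂ v′)))

  -- The images of α and β would live in a larger universe; they are cut out instead by asking that the
  -- K- (resp. G′-) component of φ a be a power of wK (resp. w′).
  S₁ S₂ : Pred Q.Carrier ℓ
  S₁ q = KT.⟨ wK ⟩ (proj₂ q)
  S₂ q = G′T.⟨ w′ ⟩ (proj₁ q)

  S₁-sub : IsSubgroup Q S₁
  S₁-sub = quotient-isSubgroup
    (preimage-isSubgroup (proj₂-isHom {G = G′} {H = K}) (KT.FiniteOrder.⟨g⟩-isSubgroup {p′} wK Kc.central-power^p≈ε))
    λ q (k , q≈bᵏ) → k ℕ.* p′ ,
      K.trans (proj₂ q≈bᵏ) (K.trans (proj₂ (pow-b k)) (KT.FiniteOrder.pow-⁻¹≈pow {p′} wK Kc.central-power^p≈ε k))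

  S₂-sub : IsSubgroup Q S₂
  S₂-sub = quotient-isSubgroup
    (preimage-isSubgroup (proj₁-isHom {G = G′} {H = K}) (G′T.FiniteOrder.⟨g⟩-isSubgroup {p′} w′ G′c.central-power^p≈ε))
    λ q (k , q≈bᵏ) → k , G′.trans (proj₁ q≈bᵏ) (proj₁ (pow-b k))

  N₁ N₂ : Pred G.Carrier ℓ
  N₁ = S₁ ∘ φ
  N₂ = S₂ ∘ φ

  N₁-sub : IsSubgroup G N₁
  N₁-sub = preimage-isSubgroup φ-hom S₁-sub

  N₂-sub : IsSubgroup G N₂
  N₂-sub = preimage-isSubgroup φ-hom S₂-sub

  α∈N₁ : ∀ a → N₁ (α a)
  α∈N₁ a = IsSubgroup.resp S₁-sub (Q.sym (φα≈ι₁ a)) (0 , K.refl)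

  β∈N₂ : ∀ v → N₂ (β v)
  β∈N₂ v = IsSubgroup.resp S₂-sub (Q.sym (φβ≈ι₂ v)) (0 , G′.refl)

  α-w′ᵏ : ∀ k → α (pow G′ w′ k) G.≈ pow G w k
  α-w′ᵏ k = G.trans (pow-homo {G = G′} {H = G} α-hom w′ k) (GT.pow-cong k α-w′)

  β-wKᵏ : ∀ k → β (pow K wK k) G.≈ pow G w k
  β-wKᵏ k = G.trans (pow-homo {G = K} {H = G} β-hom wK k) (GT.pow-cong k β-wK)

  N₁→G′ : Σ G.Carrier N₁ → G′.Carrier
  N₁→G′ (a , k , _) = proj₁ (φ a) G′.∙ pow G′ w′ k

  α∘N₁→G′ : ∀ x → α (N₁→G′ x) G.≈ proj₁ x
  α∘N₁→G′ (a , k , φa₂≈wKᵏ) = begin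
    α (proj₁ (φ a) G′.∙ pow G′ w′ k)     ≈⟨ α.homo (proj₁ (φ a)) (pow G′ w′ k) ⟩
    α (proj₁ (φ a)) G.∙ α (pow G′ w′ k)  ≈⟨ G.∙-congˡ (G.trans (α-w′ᵏ k) (G.sym (β-wKᵏ k))) ⟩
    α (proj₁ (φ a)) G.∙ β (pow K wK k)   ≈⟨ G.∙-congˡ (β.⟦⟧-cong φa₂≈wKᵏ) ⟨
    ψ (φ a)                              ≈⟨ ψφ≈id a ⟩
    a                                    ∎
    where open SetoidReasoning G.setoid
          module α = GroupMorphisms.IsGroupHomomorphism α-hom
          module β = GroupMorphisms.IsGroupHomomorphism β-hom

  N₂→K : Σ G.Carrier N₂ → K.Carrier
  N₂→K (a , k , _) = pow K wK k K.∙ proj₂ (φ a)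

  β∘N₂→K : ∀ x → β (N₂→K x) G.≈ proj₁ x
  β∘N₂→K (a , k , φa₁≈w′ᵏ) = begin
    β (pow K wK k K.∙ proj₂ (φ a))     ≈⟨ β.homo (pow K wK k) (proj₂ (φ a)) ⟩
    β (pow K wK k) G.∙ β (proj₂ (φ a)) ≈⟨ G.∙-congʳ (G.trans (β-wKᵏ k) (G.sym (α-w′ᵏ k))) ⟩
    α (pow G′ w′ k) G.∙ β (proj₂ (φ a)) ≈⟨ G.∙-congʳ (α.⟦⟧-cong φa₁≈w′ᵏ) ⟨
    ψ (φ a)                            ≈⟨ ψφ≈id a ⟩
    a                                  ∎
    where open SetoidReasoning G.setoid
          module α = GroupMorphisms.IsGroupHomomorphism α-hom
          module β = GroupMorphisms.IsGroupHomomorphism β-hom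

  central-product : CentralProductOf G G′ K
  central-product = N₁ , N₂ , N₁-sub , N₂-sub , (generated , commute) ,
    image-subgroup≅domain {G = G} {H = G′} α-hom α-injective N₁-sub α∈N₁ N₁→G′ α∘N₁→G′ ,
    image-subgroup≅domain {G = G} {H = K} β-hom β-injective N₂-sub β∈N₂ N₂→K β∘N₂→K
    where
    generated : ∀ a → Generated G (λ x → N₁ x ⊎ N₂ x) a
    generated a = respG (ψφ≈id a) (mul (gen (inj₁ (α∈N₁ (proj₁ (φ a))))) (gen (inj₂ (β∈N₂ (proj₂ (φ a))))))
    commute : ∀ a v → N₁ a → N₂ v → GT.Commute a v
    commute a v a∈N₁ v∈N₂ =
      GT.commute-resp (G.sym (α∘N₁→G′ (a , a∈N₁))) (G.sym (β∘N₂→K (v , v∈N₂))) (α-β-commute _ _)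

  quotient-form : QuotientForm p G G′ K
  quotient-form = B , B-sub , B-central , B-size , G≅Q

isFirst-punchIn : ∀ {m} (j : Fin (suc m)) → isFirst (punchIn (suc zero) j) ≡ isFirst j
isFirst-punchIn zero    = ≡.refl
isFirst-punchIn (suc j) = ≡.refl

module _ {G G′ K : Group c ℓ} (p′ m d′ : ℕ) where

  H-splitting : IsH (suc p′) (suc m) (suc d′) G → IsH (suc p′) m (suc d′) G′ → IsH (suc p′) 1 1 K →
                CentralProductOf G G′ K × QuotientForm (suc p′) G G′ K
  H-splitting (_ , G-pres) (_ , G′-pres) (_ , K-pres) = central-product , quotient-form
    where open Splitting p′ d′ m zero ≡.refl (λ _ → ≡.refl) (H-twisted G-pres) (H-twisted G′-pres) (H-twisted K-pres)

  -- Splitting off x₂, y₂ keeps x₁, with x₁ ^ p = z, in the A(n - 1, d) factor.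
  A-splitting : IsA (suc p′) (suc (suc m)) (suc d′) G → IsA (suc p′) (suc m) (suc d′) G′ → IsH (suc p′) 1 1 K →
                CentralProductOf G G′ K × QuotientForm (suc p′) G G′ K
  A-splitting (_ , G-pres) (_ , G′-pres) (_ , K-pres) = central-product , quotient-form
    where open Splitting p′ d′ (suc m) (suc zero) ≡.refl isFirst-punchIn
                         (A-twisted G-pres) (A-twisted G′-pres) (H-twisted K-pres)

proposition4p4 : ∀ {c ℓ : Level} (p : ℕ) → Prime p → ¬ (p ≡ 2) →
    -- (a)
    (∀ (n d : ℕ) → 1 ≤ n → 1 ≤ d → (G G′ K : Group c ℓ) →
      IsH p n d G → IsH p (n ∸ 1) d G′ → IsH p 1 1 K →
      CentralProductOf G G′ K × QuotientForm p G G′ K) ×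
    -- (b)
    (∀ (n d : ℕ) → 2 ≤ n → 1 ≤ d → (G G′ K : Group c ℓ) →
      IsA p n d G → IsA p (n ∸ 1) d G′ → IsH p 1 1 K →
      CentralProductOf G G′ K × QuotientForm p G G′ K)
proposition4p4 zero     0-prime _ = ⊥-elim (¬prime[0] 0-prime)
proposition4p4 (suc p′) _       _ =
  (λ { (suc m) (suc d′) _ _ _ _ _ → H-splitting p′ m d′
     ; zero _ () ; (suc _) zero _ () }) ,
  (λ { (suc (suc m)) (suc d′) _ _ _ _ _ → A-splitting p′ m d′
     ; zero _ () ; (suc zero) _ (s≤s ()) ; (suc (suc _)) zero _ () })
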